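{- Let $S$ be a finite Kleene relation algebra satisfying the Tarski rule, let $p_0 \in S$ be a forest and let $x \in S$ be a point. Consider the program with program variables $p, y$ ranging over $S$, started with $p = p_0$: $y := x$; while $y \neq p^T\cdot y$ do $p := \big(y \sqcap (p^T\cdot p^T\cdot y)^T\big)\sqcup(\overline{y}\sqcap p)$; $y := p^T\cdot y$ od. Then the program terminates, and in its final state: $p$ is a forest; $y$ is a point; $y = ((p^T)^*\cdot x)\sqcap((p\sqcap 1)\cdot\top)$; $p^*\cdot(p^T)^* = p_0^*\cdot(p_0^T)^*$; $p\sqcap 1 = p_0\sqcap 1$; and $p = (v \sqcap (p_0\cdot p_0)) \sqcup (\overline{v}\sqcap p_0)$ where $v = ((p_0\cdot p_0)^T)^*\cdot x$.
   Context: A Kleene relation algebra is a structure $(S,\sqcup,\sqcap,\cdot,\overline{\phantom{x}},{}^T,{}^*,\bot,\top,1)$ such that $(S,\sqcup,\sqcap,\overline{\phantom{x}},\bot,\top)$ is a Boolean algebra with order $x \sqsubseteq y \iff x \sqcup y = y$; $(S,\sqcup,\cdot,\bot,1)$ is an idempotent semiring ($\cdot$ associative with two-sided unit $1$, distributing over $\sqcup$, $\bot$ a two-sided zero of $\cdot$); transposition satisfies $(x\sqcup y)^T = x^T \sqcup y^T$, $(x^T)^T = x$, $(x\cdot y)^T = y^T\cdot x^T$ and $(x\cdot y)\sqcap z \sqsubseteq x\cdot(y\sqcap(x^T\cdot z))$; and the star satisfies $1\sqcup y\cdot y^* = y^* = 1 \sqcup y^*\cdot y$, $z\sqcup y\cdot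 x\sqsubseteq x \Rightarrow y^*\cdot z\sqsubseteq x$, $z \sqcup x\cdot y \sqsubseteq x \Rightarrow z\cdot y^*\sqsubseteq x$. The Tarski rule states $\top\cdot x\cdot\top = \top$ for every $x \neq \bot$. Write $x^+ = x\cdot x^*$. An element $x$ is univalent if $x^T x\sqsubseteq 1$, total if $1\sqsubseteq x x^T$, a mapping if univalent and total, injective if $x x^T\sqsubseteq 1$, surjective if $1\sqsubseteq x^T x$, a vector if $x\cdot\top = x$, a point if it is an injective surjective vector, acyclic if $x^+\sqsubseteq\overline 1$, and a forest if it is a mapping and $x\sqcap\overline{1}$ is acyclic. Programs are sequential while-programs with the usual semantics; $p^T\cdot y$ reads the parent of node $y$ in the current $p$ (so the second loop assignment uses the updated $p$). The final equation says $p$ is the array update of $p_0$ at all nodes in $v$ (nodes reachable from $x$ in an even number of parent steps) to the value $(p_0\cdot p_0)^T$. -}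

module Defs where

open import Level using (Level) renaming (suc to lsuc)
open import Data.Nat using (ℕ)
open import Data.Fin using (Fin)
open import Data.Product using (Σ; _×_)
open import Function.Bundles using (_↔_)
open import Relation.Binary.PropositionalEquality using (_≡_; _≢_)
open import Algebra.Core using (Op₁; Op₂)
open import Algebra.Structures using (IsSemiring)
open import Algebra.Lattice.Structures using (IsBooleanAlgebra)

record KleeneRelationAlgebra (a : Level) : Set (lsuc a) where
  infixl 6 _⊔_
  infixl 7 _⊓_
  infixl 8 _·_
  infix 9 _ᵀ _*
  infix 4 _⊑_
  field
    Carrier : Set a
    _⊔_ _⊓_ _·_ : Op₂ Carrier
    ∁ _ᵀ _* : Op₁ Carrier
    ⊥ ⊤ 𝟙 : Carrier

  _⊑_ : Carrier → Carrier → Set a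
  x ⊑ y = x ⊔ y ≡ y

  field
    isBooleanAlgebra : IsBooleanAlgebra _≡_ _⊔_ _⊓_ ∁ ⊤ ⊥
    isSemiring : IsSemiring _≡_ _⊔_ _·_ ⊥ 𝟙
    ⊔-idem : ∀ x → x ⊔ x ≡ x
    ᵀ-⊔ : ∀ x y → (x ⊔ y) ᵀ ≡ x ᵀ ⊔ y ᵀ
    ᵀ-invol : ∀ x → (x ᵀ) ᵀ ≡ x
    ᵀ-· : ∀ x y → (x · y) ᵀ ≡ y ᵀ · x ᵀ
    dedekind : ∀ x y z → (x · y) ⊓ z ⊑ x · (y ⊓ (x ᵀ · z))
    *-unfoldˡ : ∀ y → 𝟙 ⊔ y · y * ≡ y *
    *-unfoldʳ : ∀ y → 𝟙 ⊔ y * · y ≡ y *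
    *-inductˡ : ∀ x y z → z ⊔ y · x ⊑ x → y * · z ⊑ x
    *-inductʳ : ∀ x y z → z ⊔ x · y ⊑ x → z · y * ⊑ x

  _⁺ : Op₁ Carrier
  x ⁺ = x · x *

  univalent total mapping injective surjective vector point acyclic forest : Carrier → Set a
  univalent x = x ᵀ · x ⊑ 𝟙
  total x = 𝟙 ⊑ x · x ᵀ
  mapping x = univalent x × total x
  injective x = x · x ᵀ ⊑ 𝟙
  surjective x = 𝟙 ⊑ x ᵀ · x
  vector x = x · ⊤ ≡ x
  point x = injective x × surjective x × vector x
  acyclic x = x ⁺ ⊑ ∁ 𝟙
  forest x = mapping x × acyclic (x ⊓ ∁ 𝟙)

  Tarski : Set a
  Tarski = ∀ x → x ≢ ⊥ → ⊤ · x · ⊤ ≡ ⊤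

  Finite : Set a
  Finite = Σ ℕ (λ n → Carrier ↔ Fin n)

  body-p : Carrier → Carrier → Carrier
  body-p p y = (y ⊓ (p ᵀ · p ᵀ · y) ᵀ) ⊔ (∁ y ⊓ p)

  -- Loop p y p' y' : the while loop "while y ≠ pᵀ·y do body od" started in
  -- state (p , y) terminates in final state (p' , y')  (big-step semantics).
  data Loop : Carrier → Carrier → Carrier → Carrier → Set a where
    loop-exit : ∀ {p y} → y ≡ p ᵀ · y → Loop p y p y
    loop-step : ∀ {p y p' y'} → y ≢ p ᵀ · y →
                Loop (body-p p y) ((body-p p y) ᵀ · y) p' y' → Loop p y p' y'

  Run : Carrier → Carrier → Carrier → Carrier → Set a
  Run p₀ x p' y' = Loop p₀ x p' y'

{-# OPTIONS --safe #-}
module Submission where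

open import Defs
open import Level using (Level)
open import Data.Nat using (ℕ)
open import Data.Fin using (Fin)
open import Data.Fin.Properties using (inj⇒≟)
open import Data.Fin.Subset using (Subset; _∈_; _⊂_)
open import Data.Fin.Subset.Induction using (⊃-wellFounded)
open import Data.Empty using (⊥-elim)
open import Data.Product using (_×_; ∃₂; _,_; proj₁; proj₂)
open import Data.Sum using (_⊎_; inj₁; inj₂)
open import Data.Vec using (tabulate)
open import Data.Vec.Properties using (lookup∘tabulate; []=⇒lookup; lookup⇒[]=)
open import Function.Bundles using (_↔_; Inverse)
open import Function.Properties.Inverse using (↔⇒↣)
open import Induction.WellFounded using (WellFounded; Acc; acc; module Subrelation)
open import Relation.Binary.Core using (Rel)
open import Relation.Binary.Definitions using (Reflexive; Transitive; Decidable; DecidableEquality)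
open import Relation.Binary.PropositionalEquality
  using (_≡_; _≢_; refl; sym; trans; cong; cong₂; subst; subst₂; isEquivalence)
open import Relation.Binary.Bundles using (Poset)
open import Relation.Nullary using (¬_; does; yes; no)
open import Relation.Nullary.Decidable using (dec-true)
open import Algebra.Lattice.Bundles using (BooleanAlgebra)
open import Algebra.Lattice.Structures using (IsBooleanAlgebra)
open import Algebra.Structures using (IsSemiring)
import Algebra.Lattice.Properties.BooleanAlgebra as BooleanAlgebraProperties
import Relation.Binary.Construct.On as On
import Relation.Binary.Reasoning.PartialOrder as PartialOrderReasoning

-- Let w be the (ghost) vector of nodes whose parent the loop has already replaced by
-- their grandparent, so that p = cond w (p₀ · p₀) p₀ and w ⊔ y is the set of visited
-- nodes.  While the loop runs, y
-- is not a root: by the Tarski rule the point y is either below the roots or disjoint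
-- from them, and a root is fixed by pᵀ.  So the body moves y into w and y to its
-- grandparent, preserving the invariant; p stays between the roots of p₀ and
-- roots ⊔ arcs⁺ of p₀, hence is a forest with the same roots.  At exit y is a root, so
-- its even-step reach is y itself and w ⊔ y is the even-step reach of x.  The loop
-- terminates since w grows strictly and strict ascent is well founded in a finite algebra.

module FiniteAscent {a ℓ} {A : Set a} {n : ℕ} (A↔Fin : A ↔ Fin n) {_≤_ : Rel A ℓ}
  (≤-refl : Reflexive _≤_) (≤-trans : Transitive _≤_) (_≤?_ : Decidable _≤_) where
  open Inverse A↔Fin using (to; from; strictlyInverseʳ)

  _>_ : Rel A ℓ
  x > y = y ≤ x × ¬ (x ≤ y)

  downset : A → Subset n
  downset x = tabulate (λ i → does (from i ≤? x))

  ∈-downset⁺ : ∀ {i x} → from i ≤ x → i ∈ downset x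
  ∈-downset⁺ {i} {x} i≤x = lookup⇒[]= i _ (trans (lookup∘tabulate _ i) (dec-true (from i ≤? x) i≤x))

  ∈-downset⁻ : ∀ {i x} → i ∈ downset x → from i ≤ x
  ∈-downset⁻ {i} {x} i∈x with from i ≤? x | trans (sym (lookup∘tabulate _ i)) ([]=⇒lookup i∈x)
  ... | yes i≤x | _ = i≤x
  ... | no _ | ()

  downset-⊂ : ∀ {x y} → x > y → downset y ⊂ downset x
  downset-⊂ {x} {y} (y≤x , x≰y) =
      (λ i∈y → ∈-downset⁺ (≤-trans (∈-downset⁻ i∈y) y≤x))
    , to x , ∈-downset⁺ (subst (_≤ x) (sym (strictlyInverseʳ x)) ≤-refl)
    , λ x∈y → x≰y (subst (_≤ y) (strictlyInverseʳ x) (∈-downset⁻ x∈y))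

  >-wellFounded : WellFounded _>_
  >-wellFounded = Subrelation.wellFounded downset-⊂ (On.wellFounded downset ⊃-wellFounded)


module Properties {ℓ : Level} (S : KleeneRelationAlgebra ℓ) where
  open KleeneRelationAlgebra S

  booleanAlgebra : BooleanAlgebra ℓ ℓ
  booleanAlgebra = record { isBooleanAlgebra = isBooleanAlgebra }

  open BooleanAlgebraProperties booleanAlgebra
    using (∧-identityʳ; ∧-identityˡ; ∨-identityʳ; ∨-identityˡ; ∧-zeroˡ; ∨-zeroʳ; ∧-idem; ¬⊥≈⊤)
  open IsBooleanAlgebra isBooleanAlgebra
    using ( ∨-comm; ∨-assoc; ∧-comm; ∧-assoc; ∨-absorbs-∧; ∧-absorbs-∨; ∧-distribˡ-∨; ∧-distribʳ-∨
          ; ∨-complementʳ; ∧-complementʳ; ∧-complementˡ)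
  open IsSemiring isSemiring using (*-assoc; *-identityˡ; *-identityʳ; distribˡ; distribʳ; zeroˡ; zeroʳ)

  ⊑-refl : ∀ {x} → x ⊑ x
  ⊑-refl = ⊔-idem _

  ⊑-trans : ∀ {x y z} → x ⊑ y → y ⊑ z → x ⊑ z
  ⊑-trans {x} {y} {z} h k = trans (cong (x ⊔_) (sym k)) (trans (sym (∨-assoc x y z)) (trans (cong (_⊔ z) h) k))

  ⊑-antisym : ∀ {x y} → x ⊑ y → y ⊑ x → x ≡ y
  ⊑-antisym {x} {y} h k = trans (sym k) (trans (∨-comm y x) h)

  ⊑-reflexive : ∀ {x y} → x ≡ y → x ⊑ y
  ⊑-reflexive refl = ⊑-refl

  ⊑-poset : Poset ℓ ℓ ℓ
  ⊑-poset = record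
    { _≤_ = _⊑_
    ; isPartialOrder = record
      { isPreorder = record { isEquivalence = isEquivalence ; reflexive = ⊑-reflexive ; trans = ⊑-trans }
      ; antisym = ⊑-antisym
      }
    }

  open PartialOrderReasoning ⊑-poset
    using (begin_; begin-equality_; step-≤; step-≡-⟩; step-≡-∣; step-≡-⟨; _∎)

  x⊑x⊔y : ∀ x y → x ⊑ x ⊔ y
  x⊑x⊔y x y = trans (sym (∨-assoc x x y)) (cong (_⊔ y) (⊔-idem x))

  y⊑x⊔y : ∀ x y → y ⊑ x ⊔ y
  y⊑x⊔y x y = subst (y ⊑_) (∨-comm y x) (x⊑x⊔y y x)

  ⊔-least : ∀ {x y z} → x ⊑ z → y ⊑ z → x ⊔ y ⊑ z
  ⊔-least {x} {y} {z} h k = trans (∨-assoc x y z) (trans (cong (x ⊔_) k) h)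

  ⊑⇒⊓≡ : ∀ {x y} → x ⊑ y → x ⊓ y ≡ x
  ⊑⇒⊓≡ {x} {y} h = trans (cong (x ⊓_) (sym h)) (∧-absorbs-∨ x y)

  ⊓≡⇒⊑ : ∀ {x y} → x ⊓ y ≡ x → x ⊑ y
  ⊓≡⇒⊑ {x} {y} h = trans (cong (_⊔ y) (sym h)) (trans (∨-comm (x ⊓ y) y) (trans (cong (y ⊔_) (∧-comm x y)) (∨-absorbs-∧ y x)))

  x⊓y⊑x : ∀ x y → x ⊓ y ⊑ x
  x⊓y⊑x x y = ⊓≡⇒⊑ (trans (∧-comm (x ⊓ y) x) (trans (sym (∧-assoc x x y)) (cong (_⊓ y) (∧-idem x))))

  x⊓y⊑y : ∀ x y → x ⊓ y ⊑ y
  x⊓y⊑y x y = subst (_⊑ y) (∧-comm y x) (x⊓y⊑x y x)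

  ⊓-greatest : ∀ {x y z} → z ⊑ x → z ⊑ y → z ⊑ x ⊓ y
  ⊓-greatest {x} {y} {z} h k = ⊓≡⇒⊑ (trans (sym (∧-assoc z x y)) (trans (cong (_⊓ y) (⊑⇒⊓≡ h)) (⊑⇒⊓≡ k)))

  ⊥⊑ : ∀ x → ⊥ ⊑ x
  ⊥⊑ x = ∨-identityˡ x

  ⊑⊤ : ∀ x → x ⊑ ⊤
  ⊑⊤ x = ∨-zeroʳ x

  ⊑⊥⇒≡⊥ : ∀ {x} → x ⊑ ⊥ → x ≡ ⊥
  ⊑⊥⇒≡⊥ h = ⊑-antisym h (⊥⊑ _)

  ⊔-mono-⊑ : ∀ {x y u v} → x ⊑ y → u ⊑ v → x ⊔ u ⊑ y ⊔ v
  ⊔-mono-⊑ h k = ⊔-least (⊑-trans h (x⊑x⊔y _ _)) (⊑-trans k (y⊑x⊔y _ _))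

  ⊓-mono-⊑ : ∀ {x y u v} → x ⊑ y → u ⊑ v → x ⊓ u ⊑ y ⊓ v
  ⊓-mono-⊑ h k = ⊓-greatest (⊑-trans (x⊓y⊑x _ _) h) (⊑-trans (x⊓y⊑y _ _) k)

  ·-monoʳ-⊑ : ∀ {x y} z → x ⊑ y → z · x ⊑ z · y
  ·-monoʳ-⊑ {x} {y} z h = trans (sym (distribˡ z x y)) (cong (z ·_) h)

  ·-monoˡ-⊑ : ∀ {x y} z → x ⊑ y → x · z ⊑ y · z
  ·-monoˡ-⊑ {x} {y} z h = trans (sym (distribʳ z x y)) (cong (_· z) h)

  ·-mono-⊑ : ∀ {x y u v} → x ⊑ y → u ⊑ v → x · u ⊑ y · v
  ·-mono-⊑ {x} {y} {u} {v} h k = ⊑-trans (·-monoˡ-⊑ u h) (·-monoʳ-⊑ y k)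

  ᵀ-mono-⊑ : ∀ {x y} → x ⊑ y → x ᵀ ⊑ y ᵀ
  ᵀ-mono-⊑ {x} {y} h = trans (sym (ᵀ-⊔ x y)) (cong _ᵀ h)

  ᵀ-cancel-⊑ : ∀ {x y} → x ᵀ ⊑ y ᵀ → x ⊑ y
  ᵀ-cancel-⊑ {x} {y} h = subst₂ _⊑_ (ᵀ-invol x) (ᵀ-invol y) (ᵀ-mono-⊑ h)

  ⊓≡⊥⇒⊑∁ : ∀ {x y} → x ⊓ y ≡ ⊥ → x ⊑ ∁ y
  ⊓≡⊥⇒⊑∁ {x} {y} h = ⊓≡⇒⊑ (sym (begin-equality
      x ≡⟨ sym (∧-identityʳ x) ⟩
      x ⊓ ⊤ ≡⟨ cong (x ⊓_) (sym (∨-complementʳ y)) ⟩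
      x ⊓ (y ⊔ ∁ y) ≡⟨ ∧-distribˡ-∨ x y (∁ y) ⟩
      x ⊓ y ⊔ x ⊓ ∁ y ≡⟨ cong (_⊔ x ⊓ ∁ y) h ⟩
      ⊥ ⊔ x ⊓ ∁ y ≡⟨ ∨-identityˡ _ ⟩
      x ⊓ ∁ y ∎))

  ⊓-partition : ∀ v x → x ≡ (v ⊓ x) ⊔ (∁ v ⊓ x)
  ⊓-partition v x = begin-equality
      x ≡⟨ sym (∧-identityˡ x) ⟩
      ⊤ ⊓ x ≡⟨ cong (_⊓ x) (sym (∨-complementʳ v)) ⟩
      (v ⊔ ∁ v) ⊓ x ≡⟨ ∧-distribʳ-∨ x v (∁ v) ⟩
      (v ⊓ x) ⊔ (∁ v ⊓ x) ∎

  ⊑⊔-cancelʳ : ∀ {x y z} → x ⊑ y ⊔ z → x ⊓ z ≡ ⊥ → x ⊑ y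
  ⊑⊔-cancelʳ {x} {y} {z} h d = begin
      x ≡⟨ ⊓-partition z x ⟩
      z ⊓ x ⊔ ∁ z ⊓ x ≡⟨ cong (_⊔ ∁ z ⊓ x) (trans (∧-comm z x) d) ⟩
      ⊥ ⊔ ∁ z ⊓ x ≡⟨ ∨-identityˡ _ ⟩
      ∁ z ⊓ x ≤⟨ ⊓-mono-⊑ ⊑-refl h ⟩
      ∁ z ⊓ (y ⊔ z) ≡⟨ ∧-distribˡ-∨ (∁ z) y z ⟩
      ∁ z ⊓ y ⊔ ∁ z ⊓ z ≡⟨ cong (∁ z ⊓ y ⊔_) (∧-complementˡ z) ⟩
      ∁ z ⊓ y ⊔ ⊥ ≡⟨ ∨-identityʳ _ ⟩
      ∁ z ⊓ y ≤⟨ x⊓y⊑y _ _ ⟩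
      y ∎

  ⊓≡⊥-antiˡ : ∀ {x x' y} → x' ⊑ x → x ⊓ y ≡ ⊥ → x' ⊓ y ≡ ⊥
  ⊓≡⊥-antiˡ h d = ⊑⊥⇒≡⊥ (⊑-trans (⊓-mono-⊑ h ⊑-refl) (⊑-reflexive d))

  ⊓≡⊥-antiʳ : ∀ {x y y'} → y' ⊑ y → x ⊓ y ≡ ⊥ → x ⊓ y' ≡ ⊥
  ⊓≡⊥-antiʳ h d = ⊑⊥⇒≡⊥ (⊑-trans (⊓-mono-⊑ ⊑-refl h) (⊑-reflexive d))

  ⊓≡⊥-sym : ∀ {x y} → x ⊓ y ≡ ⊥ → y ⊓ x ≡ ⊥
  ⊓≡⊥-sym {x} {y} d = trans (∧-comm y x) d

  ᵀ-⊤ : ⊤ ᵀ ≡ ⊤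
  ᵀ-⊤ = ⊑-antisym (⊑⊤ _) (subst (_⊑ ⊤ ᵀ) (ᵀ-invol ⊤) (ᵀ-mono-⊑ (⊑⊤ (⊤ ᵀ))))

  ᵀ-𝟙 : 𝟙 ᵀ ≡ 𝟙
  ᵀ-𝟙 = begin-equality
      𝟙 ᵀ ≡⟨ sym (*-identityʳ (𝟙 ᵀ)) ⟩
      𝟙 ᵀ · 𝟙 ≡⟨ cong (𝟙 ᵀ ·_) (sym (ᵀ-invol 𝟙)) ⟩
      𝟙 ᵀ · (𝟙 ᵀ) ᵀ ≡⟨ sym (ᵀ-· (𝟙 ᵀ) 𝟙) ⟩
      (𝟙 ᵀ · 𝟙) ᵀ ≡⟨ cong _ᵀ (*-identityʳ (𝟙 ᵀ)) ⟩
      (𝟙 ᵀ) ᵀ ≡⟨ ᵀ-invol 𝟙 ⟩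
      𝟙 ∎

  ᵀ-⊓ : ∀ x y → (x ⊓ y) ᵀ ≡ x ᵀ ⊓ y ᵀ
  ᵀ-⊓ x y = ⊑-antisym (⊓-greatest (ᵀ-mono-⊑ (x⊓y⊑x x y)) (ᵀ-mono-⊑ (x⊓y⊑y x y)))
    (subst (_⊑ (x ⊓ y) ᵀ) (ᵀ-invol _) (ᵀ-mono-⊑ (⊓-greatest
       (subst ((x ᵀ ⊓ y ᵀ) ᵀ ⊑_) (ᵀ-invol x) (ᵀ-mono-⊑ (x⊓y⊑x (x ᵀ) (y ᵀ))))
       (subst ((x ᵀ ⊓ y ᵀ) ᵀ ⊑_) (ᵀ-invol y) (ᵀ-mono-⊑ (x⊓y⊑y (x ᵀ) (y ᵀ)))))))

  dedekindʳ : ∀ x y z → x · y ⊓ z ⊑ (x ⊓ z · y ᵀ) · y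
  dedekindʳ x y z = ᵀ-cancel-⊑ (begin
      (x · y ⊓ z) ᵀ ≡⟨ ᵀ-⊓ _ _ ⟩
      (x · y) ᵀ ⊓ z ᵀ ≡⟨ cong (_⊓ z ᵀ) (ᵀ-· x y) ⟩
      y ᵀ · x ᵀ ⊓ z ᵀ ≤⟨ dedekind (y ᵀ) (x ᵀ) (z ᵀ) ⟩
      y ᵀ · (x ᵀ ⊓ (y ᵀ) ᵀ · z ᵀ) ≡⟨ cong (λ u → y ᵀ · (x ᵀ ⊓ u)) (sym (ᵀ-· z (y ᵀ))) ⟩
      y ᵀ · (x ᵀ ⊓ (z · y ᵀ) ᵀ) ≡⟨ cong (y ᵀ ·_) (sym (ᵀ-⊓ _ _)) ⟩
      y ᵀ · (x ⊓ z · y ᵀ) ᵀ ≡⟨ sym (ᵀ-· _ _) ⟩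
      ((x ⊓ z · y ᵀ) · y) ᵀ ∎)

  x⊑x·xᵀ·x : ∀ t → t ⊑ t · (t ᵀ · t)
  x⊑x·xᵀ·x t = begin
      t ≡⟨ sym (∧-idem t) ⟩
      t ⊓ t ≡⟨ cong (_⊓ t) (sym (*-identityʳ t)) ⟩
      t · 𝟙 ⊓ t ≤⟨ dedekind t 𝟙 t ⟩
      t · (𝟙 ⊓ t ᵀ · t) ≤⟨ ·-monoʳ-⊑ t (x⊓y⊑y _ _) ⟩
      t · (t ᵀ · t) ∎

  test⊑testᵀ : ∀ {t} → t ⊑ 𝟙 → t ⊑ t ᵀ
  test⊑testᵀ {t} h = begin
      t ≤⟨ x⊑x·xᵀ·x t ⟩
      t · (t ᵀ · t) ≤⟨ ·-mono-⊑ h (·-monoʳ-⊑ (t ᵀ) h) ⟩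
      𝟙 · (t ᵀ · 𝟙) ≡⟨ *-identityˡ _ ⟩
      t ᵀ · 𝟙 ≡⟨ *-identityʳ _ ⟩
      t ᵀ ∎

  test-ᵀ : ∀ {t} → t ⊑ 𝟙 → t ᵀ ≡ t
  test-ᵀ {t} h = ⊑-antisym (subst (t ᵀ ⊑_) (ᵀ-invol t) (test⊑testᵀ (subst (t ᵀ ⊑_) ᵀ-𝟙 (ᵀ-mono-⊑ h)))) (test⊑testᵀ h)

  x⊓𝟙⊑xᵀ : ∀ x → x ⊓ 𝟙 ⊑ x ᵀ
  x⊓𝟙⊑xᵀ x = subst (_⊑ x ᵀ) (test-ᵀ (x⊓y⊑y x 𝟙)) (ᵀ-mono-⊑ (x⊓y⊑x x 𝟙))

  test·⊑test·⊤⊓ : ∀ {t} z → t ⊑ 𝟙 → t · z ⊑ t · ⊤ ⊓ z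
  test·⊑test·⊤⊓ {t} z h = ⊓-greatest (·-monoʳ-⊑ t (⊑⊤ z)) (⊑-trans (·-monoˡ-⊑ z h) (⊑-reflexive (*-identityˡ z)))

  test·⊤⊓⊑test· : ∀ {t} z → t ⊑ 𝟙 → t · ⊤ ⊓ z ⊑ t · z
  test·⊤⊓⊑test· {t} z h = begin
      t · ⊤ ⊓ z ≤⟨ dedekind t ⊤ z ⟩
      t · (⊤ ⊓ t ᵀ · z) ≤⟨ ·-monoʳ-⊑ t (x⊓y⊑y _ _) ⟩
      t · (t ᵀ · z) ≤⟨ ·-monoʳ-⊑ t (·-monoˡ-⊑ z (subst (t ᵀ ⊑_) ᵀ-𝟙 (ᵀ-mono-⊑ h))) ⟩
      t · (𝟙 · z) ≡⟨ cong (t ·_) (*-identityˡ z) ⟩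
      t · z ∎

  vector-⊓ : ∀ {v} z → vector v → v ⊓ z ≡ (v ⊓ 𝟙) · z
  vector-⊓ {v} z hv = ⊑-antisym
      (begin
        v ⊓ z ≡⟨ ∧-comm v z ⟩
        z ⊓ v ≡⟨ cong (_⊓ v) (sym (*-identityˡ z)) ⟩
        𝟙 · z ⊓ v ≤⟨ dedekindʳ 𝟙 z v ⟩
        (𝟙 ⊓ v · z ᵀ) · z ≤⟨ ·-monoˡ-⊑ z (⊓-mono-⊑ ⊑-refl (subst (v · z ᵀ ⊑_) hv (·-monoʳ-⊑ v (⊑⊤ _)))) ⟩
        (𝟙 ⊓ v) · z ≡⟨ cong (_· z) (∧-comm 𝟙 v) ⟩
        (v ⊓ 𝟙) · z ∎)
      (⊓-greatest (subst ((v ⊓ 𝟙) · z ⊑_) hv (·-mono-⊑ (x⊓y⊑x v 𝟙) (⊑⊤ z)))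
             (⊑-trans (·-monoˡ-⊑ z (x⊓y⊑y v 𝟙)) (⊑-reflexive (*-identityˡ z))))

  vector-⊓-ᵀ· : ∀ {v} s z → vector v → (v ⊓ s) ᵀ · z ≡ s ᵀ · (v ⊓ z)
  vector-⊓-ᵀ· {v} s z hv = begin-equality
      (v ⊓ s) ᵀ · z ≡⟨ cong (λ u → u ᵀ · z) (vector-⊓ s hv) ⟩
      ((v ⊓ 𝟙) · s) ᵀ · z ≡⟨ cong (_· z) (ᵀ-· _ _) ⟩
      s ᵀ · (v ⊓ 𝟙) ᵀ · z ≡⟨ cong (λ u → s ᵀ · u · z) (test-ᵀ (x⊓y⊑y v 𝟙)) ⟩
      s ᵀ · (v ⊓ 𝟙) · z ≡⟨ *-assoc _ _ _ ⟩
      s ᵀ · ((v ⊓ 𝟙) · z) ≡⟨ cong (s ᵀ ·_) (sym (vector-⊓ z hv)) ⟩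
      s ᵀ · (v ⊓ z) ∎

  ∁-vector : ∀ {v} → vector v → vector (∁ v)
  ∁-vector {v} hv = ⊑-antisym
      (⊓≡⊥⇒⊑∁ (⊑⊥⇒≡⊥ (begin
         ∁ v · ⊤ ⊓ v ≤⟨ dedekindʳ (∁ v) ⊤ v ⟩
         (∁ v ⊓ v · ⊤ ᵀ) · ⊤ ≡⟨ cong (λ u → (∁ v ⊓ v · u) · ⊤) ᵀ-⊤ ⟩
         (∁ v ⊓ v · ⊤) · ⊤ ≡⟨ cong (λ u → (∁ v ⊓ u) · ⊤) hv ⟩
         (∁ v ⊓ v) · ⊤ ≡⟨ cong (_· ⊤) (∧-complementˡ v) ⟩
         ⊥ · ⊤ ≡⟨ zeroˡ ⊤ ⟩
         ⊥ ∎)))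
      (subst (_⊑ ∁ v · ⊤) (*-identityʳ (∁ v)) (·-monoʳ-⊑ (∁ v) (⊑⊤ 𝟙)))

  vector-⊓-·⊤ : ∀ {v} s → vector v → (v ⊓ s) · ⊤ ≡ v ⊓ s · ⊤
  vector-⊓-·⊤ {v} s hv = begin-equality
      (v ⊓ s) · ⊤ ≡⟨ cong (_· ⊤) (vector-⊓ s hv) ⟩
      (v ⊓ 𝟙) · s · ⊤ ≡⟨ *-assoc _ _ _ ⟩
      (v ⊓ 𝟙) · (s · ⊤) ≡⟨ sym (vector-⊓ _ hv) ⟩
      v ⊓ s · ⊤ ∎

  ⊓-vector : ∀ {v u} → vector v → vector u → vector (v ⊓ u)
  ⊓-vector {v} {u} hv hu = trans (vector-⊓-·⊤ u hv) (cong (v ⊓_) hu)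

  ⊔-vector : ∀ {v u} → vector v → vector u → vector (v ⊔ u)
  ⊔-vector {v} {u} hv hu = trans (distribʳ ⊤ v u) (cong₂ _⊔_ hv hu)

  ·-vector : ∀ {v} f → vector v → vector (f · v)
  ·-vector {v} f hv = trans (*-assoc f v ⊤) (cong (f ·_) hv)

  ⊥-vector : vector ⊥
  ⊥-vector = zeroˡ ⊤

  ⊤-vector : vector ⊤
  ⊤-vector = ⊑-antisym (⊑⊤ _) (⊑-trans (⊑-reflexive (sym (*-identityˡ ⊤))) (·-monoˡ-⊑ ⊤ (⊑⊤ 𝟙)))

  x⊑x·⊤ : ∀ x → x ⊑ x · ⊤
  x⊑x·⊤ x = ⊑-trans (⊑-reflexive (sym (*-identityʳ x))) (·-monoʳ-⊑ x (⊑⊤ 𝟙))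

  point⇒injective : ∀ {y} → point y → injective y
  point⇒injective = proj₁
  point⇒surjective : ∀ {y} → point y → surjective y
  point⇒surjective h = proj₁ (proj₂ h)
  point⇒vector : ∀ {y} → point y → vector y
  point⇒vector h = proj₂ (proj₂ h)

  ᵀ·-ᵀ : ∀ f y → (f ᵀ · y) ᵀ ≡ y ᵀ · f
  ᵀ·-ᵀ f y = trans (ᵀ-· (f ᵀ) y) (cong (y ᵀ ·_) (ᵀ-invol f))

  point-⊓ : ∀ {y} f → point y → y ⊓ f ≡ y ⊓ (f ᵀ · y) ᵀ
  point-⊓ {y} f hy = trans (⊑-antisym
      (⊓-greatest (x⊓y⊑x y f) (begin
          y ⊓ f         ≡⟨ vector-⊓ f (point⇒vector hy) ⟩
          (y ⊓ 𝟙) · f   ≤⟨ ·-monoˡ-⊑ f (x⊓𝟙⊑xᵀ y) ⟩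
          y ᵀ · f       ∎))
      (⊓-greatest (x⊓y⊑x _ _) (begin
          y ⊓ y ᵀ · f ≡⟨ vector-⊓ _ (point⇒vector hy) ⟩
          (y ⊓ 𝟙) · (y ᵀ · f) ≤⟨ ·-monoˡ-⊑ _ (x⊓y⊑x y 𝟙) ⟩
          y · (y ᵀ · f) ≡⟨ sym (*-assoc _ _ _) ⟩
          y · y ᵀ · f ≤⟨ ·-monoˡ-⊑ f (point⇒injective hy) ⟩
          𝟙 · f ≡⟨ *-identityˡ f ⟩
          f ∎)))
    (cong (y ⊓_) (sym (ᵀ·-ᵀ f y)))

  injective-·⊓ : ∀ {y} A → injective y → A · y ⊓ y ⊑ (A ⊓ 𝟙) · y
  injective-·⊓ {y} A hy = ⊑-trans (dedekindʳ A y y) (·-monoˡ-⊑ y (⊓-mono-⊑ ⊑-refl hy))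

  mapping-ᵀ·-point : ∀ {f y} → mapping f → point y → point (f ᵀ · y)
  mapping-ᵀ·-point {f} {y} (uf , tf) (iy , sy , vy) =
      (begin
        f ᵀ · y · (f ᵀ · y) ᵀ ≡⟨ cong (f ᵀ · y ·_) (ᵀ·-ᵀ f y) ⟩
        f ᵀ · y · (y ᵀ · f) ≡⟨ *-assoc _ _ _ ⟩
        f ᵀ · (y · (y ᵀ · f)) ≡⟨ cong (f ᵀ ·_) (sym (*-assoc _ _ _)) ⟩
        f ᵀ · (y · y ᵀ · f) ≤⟨ ·-monoʳ-⊑ (f ᵀ) (·-monoˡ-⊑ f iy) ⟩
        f ᵀ · (𝟙 · f) ≡⟨ cong (f ᵀ ·_) (*-identityˡ f) ⟩
        f ᵀ · f ≤⟨ uf ⟩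
        𝟙 ∎)
    , (begin
        𝟙 ≤⟨ sy ⟩
        y ᵀ · y ≡⟨ cong (_· y) (sym (*-identityʳ _)) ⟩
        y ᵀ · 𝟙 · y ≤⟨ ·-monoˡ-⊑ y (·-monoʳ-⊑ (y ᵀ) tf) ⟩
        y ᵀ · (f · f ᵀ) · y ≡⟨ cong (_· y) (sym (*-assoc _ _ _)) ⟩
        y ᵀ · f · f ᵀ · y ≡⟨ *-assoc _ _ _ ⟩
        y ᵀ · f · (f ᵀ · y) ≡⟨ cong (_· (f ᵀ · y)) (sym (ᵀ·-ᵀ f y)) ⟩
        (f ᵀ · y) ᵀ · (f ᵀ · y) ∎)
    , ·-vector (f ᵀ) vy

  surjective⇒⊤·≡⊤ : ∀ {y} → surjective y → ⊤ · y ≡ ⊤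
  surjective⇒⊤·≡⊤ {y} sy = ⊑-antisym (⊑⊤ _) (begin
      ⊤ ≡⟨ sym (*-identityʳ ⊤) ⟩
      ⊤ · 𝟙 ≤⟨ ·-monoʳ-⊑ ⊤ sy ⟩
      ⊤ · (y ᵀ · y) ≡⟨ sym (*-assoc _ _ _) ⟩
      ⊤ · y ᵀ · y ≤⟨ ·-monoˡ-⊑ y (⊑⊤ _) ⟩
      ⊤ · y ∎)

  vector-·-surjective : ∀ {v y} → vector v → surjective y → v · y ≡ v
  vector-·-surjective {v} {y} hv sy = begin-equality
      v · y ≡⟨ cong (_· y) (sym hv) ⟩
      v · ⊤ · y ≡⟨ *-assoc _ _ _ ⟩
      v · (⊤ · y) ≡⟨ cong (v ·_) (surjective⇒⊤·≡⊤ sy) ⟩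
      v · ⊤ ≡⟨ hv ⟩
      v ∎

  point-⊑⇒≡ : ∀ {y z} → point y → point z → y ⊑ z → y ≡ z
  point-⊑⇒≡ {y} {z} hy hz h = ⊑-antisym h (begin
      z ≡⟨ sym (*-identityʳ z) ⟩
      z · 𝟙 ≤⟨ ·-monoʳ-⊑ z (point⇒surjective hy) ⟩
      z · (y ᵀ · y) ≤⟨ ·-monoʳ-⊑ z (·-monoˡ-⊑ y (ᵀ-mono-⊑ h)) ⟩
      z · (z ᵀ · y) ≡⟨ sym (*-assoc _ _ _) ⟩
      z · z ᵀ · y ≤⟨ ·-monoˡ-⊑ y (point⇒injective hz) ⟩
      𝟙 · y ≡⟨ *-identityˡ y ⟩
      y ∎)

  vector-⊓⊑· : ∀ {y} z → vector y → y ⊓ z ᵀ ⊑ y · z ᵀ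
  vector-⊓⊑· {y} z hy = ⊑-trans (⊑-reflexive (vector-⊓ _ hy)) (·-monoˡ-⊑ _ (x⊓y⊑x y 𝟙))

  -- If y ⊓ u ≠ ⊥ then ⊤ · (y ⊓ u) = ⊤ by the Tarski rule, and the injective y lies below y ⊓ u.
  point-⊑-or-disjoint : DecidableEquality Carrier → Tarski →
                        ∀ {y u} → point y → vector u → y ⊑ u ⊎ y ⊓ u ≡ ⊥
  point-⊑-or-disjoint _≟_ tarski {y} {u} (y-inj , _ , y-vector) u-vector with (y ⊓ u) ≟ ⊥
  ... | yes y⊓u≡⊥ = inj₂ y⊓u≡⊥
  ... | no y⊓u≢⊥ = inj₁ (begin
          y                 ≡⟨ sym y-vector ⟩
          y · ⊤             ≡⟨ cong (y ·_) (sym sᵀ·⊤≡⊤) ⟩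
          y · (s ᵀ · ⊤)     ≡⟨ sym (*-assoc _ _ _) ⟩
          y · s ᵀ · ⊤       ≡⟨ cong (_· ⊤) (sym (test-ᵀ y·sᵀ⊑𝟙)) ⟩
          (y · s ᵀ) ᵀ · ⊤   ≡⟨ cong (_· ⊤) (trans (ᵀ-· y (s ᵀ)) (cong (_· y ᵀ) (ᵀ-invol s))) ⟩
          s · y ᵀ · ⊤       ≡⟨ *-assoc _ _ _ ⟩
          s · (y ᵀ · ⊤)     ≤⟨ ·-monoʳ-⊑ s (⊑⊤ _) ⟩
          s · ⊤             ≡⟨ s-vector ⟩
          s                 ≤⟨ x⊓y⊑y y u ⟩
          u                 ∎)
    where
    s : Carrier
    s = y ⊓ u
    s-vector : vector s
    s-vector = ⊓-vector y-vector u-vector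
    ⊤·s≡⊤ : ⊤ · s ≡ ⊤
    ⊤·s≡⊤ = trans (cong (⊤ ·_) (sym s-vector)) (trans (sym (*-assoc _ _ _)) (tarski s y⊓u≢⊥))
    sᵀ·⊤≡⊤ : s ᵀ · ⊤ ≡ ⊤
    sᵀ·⊤≡⊤ = trans (cong (s ᵀ ·_) (sym ᵀ-⊤)) (trans (sym (ᵀ-· ⊤ s)) (trans (cong _ᵀ ⊤·s≡⊤) ᵀ-⊤))
    y·sᵀ⊑𝟙 : y · s ᵀ ⊑ 𝟙
    y·sᵀ⊑𝟙 = ⊑-trans (·-monoʳ-⊑ y (ᵀ-mono-⊑ (x⊓y⊑x y u))) y-inj

  𝟙⊑* : ∀ x → 𝟙 ⊑ x *
  𝟙⊑* x = subst (𝟙 ⊑_) (*-unfoldˡ x) (x⊑x⊔y 𝟙 _)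

  x·x*⊑x* : ∀ x → x · x * ⊑ x *
  x·x*⊑x* x = subst (x · x * ⊑_) (*-unfoldˡ x) (y⊑x⊔y 𝟙 _)

  x*·x⊑x* : ∀ x → x * · x ⊑ x *
  x*·x⊑x* x = subst (x * · x ⊑_) (*-unfoldʳ x) (y⊑x⊔y 𝟙 _)

  x⊑x* : ∀ x → x ⊑ x *
  x⊑x* x = begin x ≡⟨ sym (*-identityʳ x) ⟩ x · 𝟙 ≤⟨ ·-monoʳ-⊑ x (𝟙⊑* x) ⟩ x · x * ≤⟨ x·x*⊑x* x ⟩ x * ∎

  x⊑*·x : ∀ a x → x ⊑ a * · x
  x⊑*·x a x = ⊑-trans (⊑-reflexive (sym (*-identityˡ x))) (·-monoˡ-⊑ x (𝟙⊑* a))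

  *-inductˡ′ : ∀ {X y z} → z ⊑ X → y · X ⊑ X → y * · z ⊑ X
  *-inductˡ′ {X} {y} {z} h k = *-inductˡ X y z (⊔-least h k)

  *-inductʳ′ : ∀ {X y z} → z ⊑ X → X · y ⊑ X → z · y * ⊑ X
  *-inductʳ′ {X} {y} {z} h k = *-inductʳ X y z (⊔-least h k)

  *-least : ∀ {e u} → 𝟙 ⊑ e → u · e ⊑ e → u * ⊑ e
  *-least {e} {u} h k = subst (_⊑ e) (*-identityʳ _) (*-inductˡ′ h k)

  *·*⊑* : ∀ x → x * · x * ⊑ x *
  *·*⊑* x = *-inductˡ′ ⊑-refl (x·x*⊑x* x)

  *-mono-⊑ : ∀ {x y} → x ⊑ y → x * ⊑ y *
  *-mono-⊑ {x} {y} h = *-least (𝟙⊑* y) (⊑-trans (·-monoˡ-⊑ (y *) h) (x·x*⊑x* y))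

  *-ᵀ : ∀ x → (x *) ᵀ ≡ (x ᵀ) *
  *-ᵀ x = ⊑-antisym
      (ᵀ-cancel-⊑ (subst (_⊑ ((x ᵀ) *) ᵀ) (sym (ᵀ-invol _)) (*-least
        (subst (_⊑ ((x ᵀ) *) ᵀ) ᵀ-𝟙 (ᵀ-mono-⊑ (𝟙⊑* (x ᵀ))))
        (begin
          x · ((x ᵀ) *) ᵀ ≡⟨ cong (_· ((x ᵀ) *) ᵀ) (sym (ᵀ-invol x)) ⟩
          (x ᵀ) ᵀ · ((x ᵀ) *) ᵀ ≡⟨ sym (ᵀ-· _ _) ⟩
          ((x ᵀ) * · x ᵀ) ᵀ ≤⟨ ᵀ-mono-⊑ (x*·x⊑x* (x ᵀ)) ⟩
          ((x ᵀ) *) ᵀ ∎))))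
      (*-least (subst (_⊑ (x *) ᵀ) ᵀ-𝟙 (ᵀ-mono-⊑ (𝟙⊑* x)))
        (begin x ᵀ · (x *) ᵀ ≡⟨ sym (ᵀ-· _ _) ⟩ (x * · x) ᵀ ≤⟨ ᵀ-mono-⊑ (x*·x⊑x* x) ⟩ (x *) ᵀ ∎))

  x⊑x⁺ : ∀ x → x ⊑ x ⁺
  x⊑x⁺ x = begin x ≡⟨ sym (*-identityʳ x) ⟩ x · 𝟙 ≤⟨ ·-monoʳ-⊑ x (𝟙⊑* x) ⟩ x · x * ∎

  x⁺·x⊑x⁺ : ∀ x → x ⁺ · x ⊑ x ⁺
  x⁺·x⊑x⁺ x = begin x · x * · x ≡⟨ *-assoc _ _ _ ⟩ x · (x * · x) ≤⟨ ·-monoʳ-⊑ x (x*·x⊑x* x) ⟩ x · x * ∎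

  ⁺·⁺⊑⁺ : ∀ x → x ⁺ · x ⁺ ⊑ x ⁺
  ⁺·⁺⊑⁺ x = begin
      x · x * · (x · x *) ≡⟨ *-assoc _ _ _ ⟩
      x · (x * · (x · x *)) ≤⟨ ·-monoʳ-⊑ x (·-monoʳ-⊑ (x *) (x·x*⊑x* x)) ⟩
      x · (x * · x *) ≤⟨ ·-monoʳ-⊑ x (*·*⊑* x) ⟩
      x · x * ∎

  ⁺⁺⊑⁺ : ∀ x → (x ⁺) ⁺ ⊑ x ⁺
  ⁺⁺⊑⁺ x = *-inductʳ′ ⊑-refl (⁺·⁺⊑⁺ x)

  ⁺-mono-⊑ : ∀ {x y} → x ⊑ y → x ⁺ ⊑ y ⁺
  ⁺-mono-⊑ h = ·-mono-⊑ h (*-mono-⊑ h)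

  -- Equivalence closure of a univalent element
  connected : Carrier → Carrier
  connected x = x * · (x ᵀ) *

  ᵀ*·*⊑connected : ∀ {x} → univalent x → (x ᵀ) * · x * ⊑ connected x
  ᵀ*·*⊑connected {x} ux = *-inductˡ′
      (subst (_⊑ connected x) (*-identityʳ _) (·-monoʳ-⊑ (x *) (𝟙⊑* _)))
      (begin
        x ᵀ · (x * · (x ᵀ) *) ≡⟨ sym (*-assoc _ _ _) ⟩
        x ᵀ · x * · (x ᵀ) * ≤⟨ ·-monoˡ-⊑ _ step ⟩
        (x ᵀ ⊔ x *) · (x ᵀ) * ≡⟨ distribʳ _ _ _ ⟩
        x ᵀ · (x ᵀ) * ⊔ x * · (x ᵀ) * ≤⟨ ⊔-least (⊑-trans (x·x*⊑x* (x ᵀ)) xᵀ*⊑) ⊑-refl ⟩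
        connected x ∎)
    where
    xᵀ*⊑ : (x ᵀ) * ⊑ connected x
    xᵀ*⊑ = subst (_⊑ connected x) (*-identityˡ _) (·-monoˡ-⊑ _ (𝟙⊑* x))
    step : x ᵀ · x * ⊑ x ᵀ ⊔ x *
    step = begin
      x ᵀ · x * ≡⟨ cong (x ᵀ ·_) (sym (*-unfoldˡ x)) ⟩
      x ᵀ · (𝟙 ⊔ x · x *) ≡⟨ distribˡ _ _ _ ⟩
      x ᵀ · 𝟙 ⊔ x ᵀ · (x · x *) ≡⟨ cong₂ _⊔_ (*-identityʳ _) (sym (*-assoc _ _ _)) ⟩
      x ᵀ ⊔ x ᵀ · x · x * ≤⟨ ⊔-mono-⊑ ⊑-refl (·-monoˡ-⊑ (x *) ux) ⟩
      x ᵀ ⊔ 𝟙 · x * ≡⟨ cong (x ᵀ ⊔_) (*-identityˡ _) ⟩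
      x ᵀ ⊔ x * ∎

  connected-transitive : ∀ {x} → univalent x → connected x · connected x ⊑ connected x
  connected-transitive {x} ux = begin
      x * · (x ᵀ) * · (x * · (x ᵀ) *) ≡⟨ *-assoc _ _ _ ⟩
      x * · ((x ᵀ) * · (x * · (x ᵀ) *)) ≡⟨ cong (x * ·_) (sym (*-assoc _ _ _)) ⟩
      x * · ((x ᵀ) * · x * · (x ᵀ) *) ≤⟨ ·-monoʳ-⊑ (x *) (·-monoˡ-⊑ _ (ᵀ*·*⊑connected ux)) ⟩
      x * · (x * · (x ᵀ) * · (x ᵀ) *) ≡⟨ cong (x * ·_) (*-assoc _ _ _) ⟩
      x * · (x * · ((x ᵀ) * · (x ᵀ) *)) ≤⟨ ·-monoʳ-⊑ (x *) (·-monoʳ-⊑ (x *) (*·*⊑* _)) ⟩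
      x * · (x * · (x ᵀ) *) ≡⟨ sym (*-assoc _ _ _) ⟩
      x * · x * · (x ᵀ) * ≤⟨ ·-monoˡ-⊑ _ (*·*⊑* x) ⟩
      connected x ∎

  𝟙⊑connected : ∀ x → 𝟙 ⊑ connected x
  𝟙⊑connected x = subst (_⊑ connected x) (*-identityʳ 𝟙) (·-mono-⊑ (𝟙⊑* x) (𝟙⊑* _))

  connected-ᵀ : ∀ x → (connected x) ᵀ ≡ connected x
  connected-ᵀ x = begin-equality
      (x * · (x ᵀ) *) ᵀ ≡⟨ ᵀ-· _ _ ⟩
      ((x ᵀ) *) ᵀ · (x *) ᵀ ≡⟨ cong₂ _·_ (*-ᵀ (x ᵀ)) (*-ᵀ x) ⟩
      ((x ᵀ) ᵀ) * · (x ᵀ) * ≡⟨ cong (λ u → u * · (x ᵀ) *) (ᵀ-invol x) ⟩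
      connected x ∎

  x⊑connected : ∀ x → x ⊑ connected x
  x⊑connected x = ⊑-trans (⊑-reflexive (sym (*-identityʳ x))) (·-mono-⊑ (x⊑x* x) (𝟙⊑* (x ᵀ)))

  x·xᵀ⊑connected : ∀ x → x · x ᵀ ⊑ connected x
  x·xᵀ⊑connected x = ·-mono-⊑ (x⊑x* x) (x⊑x* _)

  connected-least : ∀ {x u} → univalent x → u ⊑ connected x → connected u ⊑ connected x
  connected-least {x} {u} ux h = ⊑-trans (·-mono-⊑ ust uᵀst) (connected-transitive ux)
    where
    ust : u * ⊑ connected x
    ust = *-least (𝟙⊑connected x) (⊑-trans (·-monoˡ-⊑ _ h) (connected-transitive ux))
    uᵀst : (u ᵀ) * ⊑ connected x
    uᵀst = *-least (𝟙⊑connected x) (⊑-trans (·-monoˡ-⊑ _ (subst (u ᵀ ⊑_) (connected-ᵀ x) (ᵀ-mono-⊑ h))) (connected-transitive ux))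

  -- Conditional (array update)
  cond : Carrier → Carrier → Carrier → Carrier
  cond v f g = v ⊓ f ⊔ ∁ v ⊓ g

  ⊓-restrict : ∀ {u v} X → u ⊑ v → u ⊓ X ≡ u ⊓ (v ⊓ X)
  ⊓-restrict {u} {v} X h = trans (cong (_⊓ X) (sym (⊑⇒⊓≡ h))) (∧-assoc u v X)

  x⊓[x⊓y]≡x⊓y : ∀ x y → x ⊓ (x ⊓ y) ≡ x ⊓ y
  x⊓[x⊓y]≡x⊓y x y = trans (sym (∧-assoc x x y)) (cong (_⊓ y) (∧-idem x))

  ⊓≡⊥⇒⊓[⊓]≡⊥ : ∀ {x y z} → x ⊓ y ≡ ⊥ → x ⊓ (y ⊓ z) ≡ ⊥
  ⊓≡⊥⇒⊓[⊓]≡⊥ {x} {y} {z} d = trans (sym (∧-assoc x y z)) (trans (cong (_⊓ z) d) (∧-zeroˡ z))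

  ⊓-cond : ∀ v f g → v ⊓ cond v f g ≡ v ⊓ f
  ⊓-cond v f g = begin-equality
      v ⊓ (v ⊓ f ⊔ ∁ v ⊓ g) ≡⟨ ∧-distribˡ-∨ _ _ _ ⟩
      v ⊓ (v ⊓ f) ⊔ v ⊓ (∁ v ⊓ g) ≡⟨ cong₂ _⊔_ (x⊓[x⊓y]≡x⊓y v f) (⊓≡⊥⇒⊓[⊓]≡⊥ (∧-complementʳ v)) ⟩
      v ⊓ f ⊔ ⊥ ≡⟨ ∨-identityʳ _ ⟩
      v ⊓ f ∎

  ∁⊓-cond : ∀ v f g → ∁ v ⊓ cond v f g ≡ ∁ v ⊓ g
  ∁⊓-cond v f g = begin-equality
      ∁ v ⊓ (v ⊓ f ⊔ ∁ v ⊓ g) ≡⟨ ∧-distribˡ-∨ _ _ _ ⟩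
      ∁ v ⊓ (v ⊓ f) ⊔ ∁ v ⊓ (∁ v ⊓ g) ≡⟨ cong₂ _⊔_ (⊓≡⊥⇒⊓[⊓]≡⊥ (∧-complementˡ v)) (x⊓[x⊓y]≡x⊓y (∁ v) g) ⟩
      ⊥ ⊔ ∁ v ⊓ g ≡⟨ ∨-identityˡ _ ⟩
      ∁ v ⊓ g ∎

  ⊓-cond-⊑∁ : ∀ {u v} f g → u ⊑ ∁ v → u ⊓ cond v f g ≡ u ⊓ g
  ⊓-cond-⊑∁ {u} {v} f g h = trans (⊓-restrict _ h) (trans (cong (u ⊓_) (∁⊓-cond v f g)) (sym (⊓-restrict g h)))

  cond-unique : ∀ {v f g} X → v ⊓ X ≡ v ⊓ f → ∁ v ⊓ X ≡ ∁ v ⊓ g → X ≡ cond v f g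
  cond-unique {v} X h k = trans (⊓-partition v X) (cong₂ _⊔_ h k)

  cond⊑⊔ : ∀ v f g → cond v f g ⊑ f ⊔ g
  cond⊑⊔ v f g = ⊔-mono-⊑ (x⊓y⊑y v f) (x⊓y⊑y (∁ v) g)

  cond-ᵀ· : ∀ {v} f g z → vector v → (cond v f g) ᵀ · z ≡ f ᵀ · (v ⊓ z) ⊔ g ᵀ · (∁ v ⊓ z)
  cond-ᵀ· {v} f g z hv = begin-equality
      (v ⊓ f ⊔ ∁ v ⊓ g) ᵀ · z ≡⟨ cong (_· z) (ᵀ-⊔ _ _) ⟩
      ((v ⊓ f) ᵀ ⊔ (∁ v ⊓ g) ᵀ) · z ≡⟨ distribʳ _ _ _ ⟩
      (v ⊓ f) ᵀ · z ⊔ (∁ v ⊓ g) ᵀ · z ≡⟨ cong₂ _⊔_ (vector-⊓-ᵀ· f z hv) (vector-⊓-ᵀ· g z (∁-vector hv)) ⟩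
      f ᵀ · (v ⊓ z) ⊔ g ᵀ · (∁ v ⊓ z) ∎

  cond-ᵀ·-inside : ∀ {v} f g {z} → vector v → z ⊑ v → (cond v f g) ᵀ · z ≡ f ᵀ · z
  cond-ᵀ·-inside {v} f g {z} v-vector z⊑v = begin-equality
      (cond v f g) ᵀ · z                 ≡⟨ cond-ᵀ· f g z v-vector ⟩
      f ᵀ · (v ⊓ z) ⊔ g ᵀ · (∁ v ⊓ z)    ≡⟨ cong₂ (λ u u′ → f ᵀ · u ⊔ g ᵀ · u′) v⊓z≡z ∁v⊓z≡⊥ ⟩
      f ᵀ · z ⊔ g ᵀ · ⊥                  ≡⟨ cong (f ᵀ · z ⊔_) (zeroʳ _) ⟩
      f ᵀ · z ⊔ ⊥                        ≡⟨ ∨-identityʳ _ ⟩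
      f ᵀ · z                            ∎
    where
    v⊓z≡z : v ⊓ z ≡ z
    v⊓z≡z = trans (∧-comm v z) (⊑⇒⊓≡ z⊑v)
    ∁v⊓z≡⊥ : ∁ v ⊓ z ≡ ⊥
    ∁v⊓z≡⊥ = ⊓≡⊥-antiʳ z⊑v (∧-complementˡ v)

  cond-ᵀ·-outside : ∀ {v} f g {z} → vector v → z ⊓ v ≡ ⊥ → (cond v f g) ᵀ · z ≡ g ᵀ · z
  cond-ᵀ·-outside {v} f g {z} v-vector z⊓v≡⊥ = begin-equality
      (cond v f g) ᵀ · z                 ≡⟨ cond-ᵀ· f g z v-vector ⟩
      f ᵀ · (v ⊓ z) ⊔ g ᵀ · (∁ v ⊓ z)    ≡⟨ cong₂ (λ u u′ → f ᵀ · u ⊔ g ᵀ · u′) (⊓≡⊥-sym z⊓v≡⊥) ∁v⊓z≡z ⟩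
      f ᵀ · ⊥ ⊔ g ᵀ · z                  ≡⟨ cong (_⊔ g ᵀ · z) (zeroʳ _) ⟩
      ⊥ ⊔ g ᵀ · z                        ≡⟨ ∨-identityˡ _ ⟩
      g ᵀ · z                            ∎
    where
    ∁v⊓z≡z : ∁ v ⊓ z ≡ z
    ∁v⊓z≡z = trans (∧-comm _ _) (⊑⇒⊓≡ (⊓≡⊥⇒⊑∁ z⊓v≡⊥))

  ∁-anti-⊑ : ∀ {x y} → x ⊑ y → ∁ y ⊑ ∁ x
  ∁-anti-⊑ {x} {y} h = ⊓≡⊥⇒⊑∁ (⊑⊥⇒≡⊥ (begin ∁ y ⊓ x ≤⟨ ⊓-mono-⊑ ⊑-refl h ⟩ ∁ y ⊓ y ≡⟨ ∧-complementˡ y ⟩ ⊥ ∎))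

  cond-⊔ : ∀ {w y f g} X → w ⊓ X ≡ w ⊓ f → y ⊓ X ≡ y ⊓ f → ∁ (w ⊔ y) ⊓ X ≡ ∁ (w ⊔ y) ⊓ g →
           X ≡ cond (w ⊔ y) f g
  cond-⊔ {w} {y} {f} X w⊓X y⊓X = cond-unique X (begin-equality
      (w ⊔ y) ⊓ X   ≡⟨ ∧-distribʳ-∨ X w y ⟩
      w ⊓ X ⊔ y ⊓ X ≡⟨ cong₂ _⊔_ w⊓X y⊓X ⟩
      w ⊓ f ⊔ y ⊓ f ≡⟨ sym (∧-distribʳ-∨ f w y) ⟩
      (w ⊔ y) ⊓ f   ∎)

  𝟙⊑·⊤⇒total : ∀ {x} → 𝟙 ⊑ x · ⊤ → total x
  𝟙⊑·⊤⇒total {x} h = begin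
      𝟙 ≡⟨ sym (⊑⇒⊓≡ h) ⟩
      𝟙 ⊓ x · ⊤ ≡⟨ ∧-comm _ _ ⟩
      x · ⊤ ⊓ 𝟙 ≤⟨ dedekind x ⊤ 𝟙 ⟩
      x · (⊤ ⊓ x ᵀ · 𝟙) ≤⟨ ·-monoʳ-⊑ x (x⊓y⊑y _ _) ⟩
      x · (x ᵀ · 𝟙) ≡⟨ cong (x ·_) (*-identityʳ _) ⟩
      x · x ᵀ ∎

  total⇒·⊤≡⊤ : ∀ {x} → total x → x · ⊤ ≡ ⊤
  total⇒·⊤≡⊤ {x} h = ⊑-antisym (⊑⊤ _) (begin
      ⊤ ≡⟨ sym (*-identityˡ ⊤) ⟩
      𝟙 · ⊤ ≤⟨ ·-monoˡ-⊑ ⊤ h ⟩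
      x · x ᵀ · ⊤ ≡⟨ *-assoc _ _ _ ⟩
      x · (x ᵀ · ⊤) ≤⟨ ·-monoʳ-⊑ x (⊑⊤ _) ⟩
      x · ⊤ ∎)

  mapping-· : ∀ {f g} → mapping f → mapping g → mapping (f · g)
  mapping-· {f} {g} (uf , tf) (ug , tg) =
      (begin
        (f · g) ᵀ · (f · g) ≡⟨ cong (_· (f · g)) (ᵀ-· f g) ⟩
        g ᵀ · f ᵀ · (f · g) ≡⟨ *-assoc _ _ _ ⟩
        g ᵀ · (f ᵀ · (f · g)) ≡⟨ cong (g ᵀ ·_) (sym (*-assoc _ _ _)) ⟩
        g ᵀ · (f ᵀ · f · g) ≤⟨ ·-monoʳ-⊑ (g ᵀ) (·-monoˡ-⊑ g uf) ⟩
        g ᵀ · (𝟙 · g) ≡⟨ cong (g ᵀ ·_) (*-identityˡ g) ⟩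
        g ᵀ · g ≤⟨ ug ⟩
        𝟙 ∎)
    , 𝟙⊑·⊤⇒total (⊑-trans (⊑⊤ 𝟙) (⊑-reflexive (sym (trans (*-assoc f g ⊤) (trans (cong (f ·_) (total⇒·⊤≡⊤ tg)) (total⇒·⊤≡⊤ tf))))))

  cond-mapping : ∀ {v f g} → vector v → mapping f → mapping g → mapping (cond v f g)
  cond-mapping {v} {f} {g} hv (uf , tf) (ug , tg) =
      (begin
        (cond v f g) ᵀ · cond v f g ≡⟨ cond-ᵀ· f g _ hv ⟩
        f ᵀ · (v ⊓ cond v f g) ⊔ g ᵀ · (∁ v ⊓ cond v f g) ≡⟨ cong₂ _⊔_ (cong (f ᵀ ·_) (⊓-cond v f g)) (cong (g ᵀ ·_) (∁⊓-cond v f g)) ⟩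
        f ᵀ · (v ⊓ f) ⊔ g ᵀ · (∁ v ⊓ g) ≤⟨ ⊔-mono-⊑ (·-monoʳ-⊑ (f ᵀ) (x⊓y⊑y v f)) (·-monoʳ-⊑ (g ᵀ) (x⊓y⊑y (∁ v) g)) ⟩
        f ᵀ · f ⊔ g ᵀ · g ≤⟨ ⊔-least uf ug ⟩
        𝟙 ∎)
    , 𝟙⊑·⊤⇒total (begin
        𝟙 ≤⟨ ⊑⊤ 𝟙 ⟩
        ⊤ ≡⟨ sym (∨-complementʳ v) ⟩
        v ⊔ ∁ v ≡⟨ sym (cong₂ _⊔_ (⊓-total⊤ v tf) (⊓-total⊤ (∁ v) tg)) ⟩
        v ⊓ f · ⊤ ⊔ ∁ v ⊓ g · ⊤ ≡⟨ sym (cong₂ _⊔_ (vector-⊓-·⊤ f hv) (vector-⊓-·⊤ g (∁-vector hv))) ⟩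
        (v ⊓ f) · ⊤ ⊔ (∁ v ⊓ g) · ⊤ ≡⟨ sym (distribʳ _ _ _) ⟩
        cond v f g · ⊤ ∎)
    where
    ⊓-total⊤ : ∀ u {h} → total h → u ⊓ h · ⊤ ≡ u
    ⊓-total⊤ u th = trans (cong (u ⊓_) (total⇒·⊤≡⊤ th)) (∧-identityʳ u)

  injective⇒⊓·≡⊥ : ∀ {y t} A → injective y → t ⊑ 𝟙 → y ⊓ t · ⊤ ≡ ⊥ → A ⊓ 𝟙 ⊑ t → y ⊓ A · y ≡ ⊥
  injective⇒⊓·≡⊥ {y} {t} A y-inj t⊑𝟙 y⊓t≡⊥ loops⊑t = ⊑⊥⇒≡⊥ (begin
      y ⊓ A · y     ≡⟨ ∧-comm _ _ ⟩
      A · y ⊓ y     ≤⟨ injective-·⊓ A y-inj ⟩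
      (A ⊓ 𝟙) · y   ≤⟨ ·-monoˡ-⊑ y loops⊑t ⟩
      t · y         ≤⟨ test·⊑test·⊤⊓ y t⊑𝟙 ⟩
      t · ⊤ ⊓ y     ≡⟨ ∧-comm _ _ ⟩
      y ⊓ t · ⊤     ≡⟨ y⊓t≡⊥ ⟩
      ⊥             ∎)

  injective-⊑·⇒⊑⊓𝟙·⊤ : ∀ {y} A → injective y → y ⊑ A · y → y ⊑ (A ⊓ 𝟙) · ⊤
  injective-⊑·⇒⊑⊓𝟙·⊤ {y} A y-inj y⊑A·y = begin
      y             ≡⟨ sym (⊑⇒⊓≡ y⊑A·y) ⟩
      y ⊓ A · y     ≡⟨ ∧-comm _ _ ⟩
      A · y ⊓ y     ≤⟨ injective-·⊓ A y-inj ⟩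
      (A ⊓ 𝟙) · y   ≤⟨ ·-monoʳ-⊑ _ (⊑⊤ y) ⟩
      (A ⊓ 𝟙) · ⊤   ∎

  module Forest (f : Carrier) (f-forest : forest f) where
    roots arcs rootVector : Carrier
    roots = f ⊓ 𝟙
    arcs = f ⊓ ∁ 𝟙
    rootVector = roots · ⊤

    roots⊑𝟙 : roots ⊑ 𝟙
    roots⊑𝟙 = x⊓y⊑y f 𝟙

    arcs-acyclic : arcs ⁺ ⊑ ∁ 𝟙
    arcs-acyclic = proj₂ f-forest

    f≡roots⊔arcs : f ≡ roots ⊔ arcs
    f≡roots⊔arcs = trans (⊓-partition 𝟙 f) (cong₂ _⊔_ (∧-comm 𝟙 f) (∧-comm (∁ 𝟙) f))

    roots·arcs≡⊥ : roots · arcs ≡ ⊥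
    roots·arcs≡⊥ = ⊑⊥⇒≡⊥ (⊑-trans (⊓-greatest roots·arcs⊑𝟙 roots·arcs⊑∁𝟙) (⊑-reflexive (∧-complementʳ 𝟙)))
      where
      roots·arcs⊑𝟙 : roots · arcs ⊑ 𝟙
      roots·arcs⊑𝟙 = ⊑-trans (·-mono-⊑ (x⊓𝟙⊑xᵀ f) (x⊓y⊑x f (∁ 𝟙))) (proj₁ (proj₁ f-forest))
      roots·arcs⊑∁𝟙 : roots · arcs ⊑ ∁ 𝟙
      roots·arcs⊑∁𝟙 = ⊑-trans (·-monoˡ-⊑ arcs roots⊑𝟙) (⊑-trans (⊑-reflexive (*-identityˡ arcs)) (x⊓y⊑y f (∁ 𝟙)))

    -- A non-empty path of f is a loop at a root or a path of arcs, since no arc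
    -- leaves a root; so everything below bound has loops only at roots.
    bound : Carrier
    bound = roots ⊔ arcs ⁺

    f⊑bound : f ⊑ bound
    f⊑bound = ⊑-trans (⊑-reflexive f≡roots⊔arcs) (⊔-mono-⊑ ⊑-refl (x⊑x⁺ arcs))

    f⁺⊑bound : f · f * ⊑ bound
    f⁺⊑bound = *-inductʳ′ f⊑bound (begin
        (roots ⊔ arcs ⁺) · f ≡⟨ distribʳ _ _ _ ⟩
        roots · f ⊔ arcs ⁺ · f ≡⟨ cong₂ (λ u v → roots · u ⊔ arcs ⁺ · v) f≡roots⊔arcs f≡roots⊔arcs ⟩
        roots · (roots ⊔ arcs) ⊔ arcs ⁺ · (roots ⊔ arcs) ≡⟨ cong₂ _⊔_ (distribˡ _ _ _) (distribˡ _ _ _) ⟩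
        (roots · roots ⊔ roots · arcs) ⊔ (arcs ⁺ · roots ⊔ arcs ⁺ · arcs)
          ≤⟨ ⊔-mono-⊑ (⊔-least roots·roots⊑roots (⊑-trans (⊑-reflexive roots·arcs≡⊥) (⊥⊑ roots)))
                      (⊔-least arcs⁺·roots⊑arcs⁺ (x⁺·x⊑x⁺ arcs)) ⟩
        roots ⊔ arcs ⁺ ∎)
      where
      roots·roots⊑roots : roots · roots ⊑ roots
      roots·roots⊑roots = ⊑-trans (·-monoʳ-⊑ roots roots⊑𝟙) (⊑-reflexive (*-identityʳ roots))
      arcs⁺·roots⊑arcs⁺ : arcs ⁺ · roots ⊑ arcs ⁺
      arcs⁺·roots⊑arcs⁺ = ⊑-trans (·-monoʳ-⊑ (arcs ⁺) roots⊑𝟙) (⊑-reflexive (*-identityʳ _))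

    ⊑bound⇒⊓𝟙⊑roots : ∀ {v} → v ⊑ bound → v ⊓ 𝟙 ⊑ roots
    ⊑bound⇒⊓𝟙⊑roots {v} h = ⊑⊔-cancelʳ (⊑-trans (x⊓y⊑x v 𝟙) h)
      (⊑⊥⇒≡⊥ (⊑-trans (⊓-mono-⊑ (x⊓y⊑y v 𝟙) arcs-acyclic) (⊑-reflexive (∧-complementʳ 𝟙))))

    ⊑bound⇒⊓∁𝟙⊑arcs⁺ : ∀ {v} → v ⊑ bound → v ⊓ ∁ 𝟙 ⊑ arcs ⁺
    ⊑bound⇒⊓∁𝟙⊑arcs⁺ {v} h = ⊑⊔-cancelʳ (⊑-trans (x⊓y⊑x v (∁ 𝟙)) v⊑arcs⁺⊔roots)
      (⊑⊥⇒≡⊥ (⊑-trans (⊓-mono-⊑ (x⊓y⊑y v (∁ 𝟙)) roots⊑𝟙) (⊑-reflexive (∧-complementˡ 𝟙))))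
      where
      v⊑arcs⁺⊔roots : v ⊑ arcs ⁺ ⊔ roots
      v⊑arcs⁺⊔roots = ⊑-trans h (⊑-reflexive (∨-comm roots (arcs ⁺)))

    ᵀ⁺⊓𝟙⊑roots : (f ᵀ) * · f ᵀ ⊓ 𝟙 ⊑ roots
    ᵀ⁺⊓𝟙⊑roots = begin
        (f ᵀ) * · f ᵀ ⊓ 𝟙 ≡⟨ cong₂ _⊓_ (trans (cong (_· f ᵀ) (sym (*-ᵀ f))) (sym (ᵀ-· f (f *)))) (sym ᵀ-𝟙) ⟩
        (f · f *) ᵀ ⊓ 𝟙 ᵀ ≡⟨ sym (ᵀ-⊓ _ _) ⟩
        (f · f * ⊓ 𝟙) ᵀ ≤⟨ ᵀ-mono-⊑ (⊑bound⇒⊓𝟙⊑roots f⁺⊑bound) ⟩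
        roots ᵀ ≡⟨ test-ᵀ roots⊑𝟙 ⟩
        roots ∎

    ᵀ⊓𝟙⊑roots : (f ᵀ) ⊓ 𝟙 ⊑ roots
    ᵀ⊓𝟙⊑roots = begin
        f ᵀ ⊓ 𝟙 ≡⟨ cong (f ᵀ ⊓_) (sym ᵀ-𝟙) ⟩
        f ᵀ ⊓ 𝟙 ᵀ ≡⟨ sym (ᵀ-⊓ _ _) ⟩
        roots ᵀ ≡⟨ test-ᵀ roots⊑𝟙 ⟩
        roots ∎

    f·f⊑bound : f · f ⊑ bound
    f·f⊑bound = ⊑-trans (·-monoʳ-⊑ f (x⊑x* f)) f⁺⊑bound

    between-forest : ∀ {g} → mapping g → g ⊑ bound → forest g
    between-forest g-mapping g⊑bound =
      g-mapping , ⊑-trans (⁺-mono-⊑ (⊑bound⇒⊓∁𝟙⊑arcs⁺ g⊑bound)) (⊑-trans (⁺⁺⊑⁺ _) arcs-acyclic)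

    between-roots : ∀ {g} → roots ⊑ g → g ⊑ bound → g ⊓ 𝟙 ≡ roots
    between-roots roots⊑g g⊑bound = ⊑-antisym (⊑bound⇒⊓𝟙⊑roots g⊑bound) (⊓-greatest roots⊑g roots⊑𝟙)

  _⊐_ : Carrier → Carrier → Set ℓ
  x ⊐ y = y ⊑ x × ¬ (x ⊑ y)

  finite⇒≟ : Finite → DecidableEquality Carrier
  finite⇒≟ (_ , Carrier↔Fin) = inj⇒≟ (↔⇒↣ Carrier↔Fin)

  ⊐-wellFounded : Finite → WellFounded _⊐_
  ⊐-wellFounded finite@(_ , Carrier↔Fin) =
    FiniteAscent.>-wellFounded Carrier↔Fin ⊑-refl ⊑-trans (λ x y → (x ⊔ y) ≟ y)
    where
    _≟_ : DecidableEquality Carrier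
    _≟_ = finite⇒≟ finite

  module Algorithm (_≟_ : DecidableEquality Carrier) (tarski : Tarski)
                   (p₀ x : Carrier) (p₀-forest : forest p₀) (x-point : point x) where
    module F₀ = Forest p₀ p₀-forest
    open F₀ using (roots; rootVector; roots⊑𝟙)

    p₀² ancestors₀ : Carrier
    p₀² = p₀ · p₀
    ancestors₀ = (p₀ ᵀ) *

    p₀-mapping : mapping p₀
    p₀-mapping = proj₁ p₀-forest

    p₀²-mapping : mapping p₀²
    p₀²-mapping = mapping-· p₀-mapping p₀-mapping

    updated : Carrier → Carrier
    updated w = cond w p₀² p₀

    updated-⊥ : updated ⊥ ≡ p₀
    updated-⊥ = begin-equality
        ⊥ ⊓ p₀² ⊔ ∁ ⊥ ⊓ p₀ ≡⟨ cong₂ _⊔_ (∧-zeroˡ p₀²) (cong (_⊓ p₀) ¬⊥≈⊤) ⟩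
        ⊥ ⊔ ⊤ ⊓ p₀        ≡⟨ ∨-identityˡ _ ⟩
        ⊤ ⊓ p₀            ≡⟨ ∧-identityˡ _ ⟩
        p₀                ∎

    record Invariant (y w : Carrier) : Set ℓ where
      field
        y-point : point y
        w-vector : vector w
        w-avoids-ancestors : w ⊓ ancestors₀ · y ≡ ⊥
        evenReach-split : (p₀² ᵀ) * · x ≡ w ⊔ (p₀² ᵀ) * · y
        w-avoids-roots : w ⊓ rootVector ≡ ⊥
        y-reachable : y ⊑ ((updated w) ᵀ) * · x
        x-visited : x ⊑ w ⊔ y
        visited-closed : (updated w) ᵀ · w ⊑ w ⊔ y
        connected-invariant : connected (updated w) ≡ connected p₀

    initial : Invariant x ⊥
    initial = record
      { y-point = x-point
      ; w-vector = ⊥-vector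
      ; w-avoids-ancestors = ∧-zeroˡ _
      ; evenReach-split = sym (∨-identityˡ _)
      ; w-avoids-roots = ∧-zeroˡ _
      ; y-reachable = x⊑*·x _ x
      ; x-visited = y⊑x⊔y ⊥ x
      ; visited-closed = ⊑-trans (⊑-reflexive (zeroʳ _)) (⊥⊑ _)
      ; connected-invariant = cong connected updated-⊥
      }

    module Consequences {y w : Carrier} (I : Invariant y w) where
      open Invariant I

      p : Carrier
      p = updated w

      p-mapping : mapping p
      p-mapping = cond-mapping w-vector p₀²-mapping p₀-mapping

      roots⊑p : roots ⊑ p
      roots⊑p = begin
          roots                   ≡⟨ ⊓-partition w roots ⟩
          w ⊓ roots ⊔ ∁ w ⊓ roots ≡⟨ cong (_⊔ ∁ w ⊓ roots) w⊓roots≡⊥ ⟩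
          ⊥ ⊔ ∁ w ⊓ roots         ≡⟨ ∨-identityˡ _ ⟩
          ∁ w ⊓ roots             ≤⟨ ⊓-mono-⊑ ⊑-refl (x⊓y⊑x p₀ 𝟙) ⟩
          ∁ w ⊓ p₀                ≡⟨ sym (∁⊓-cond w p₀² p₀) ⟩
          ∁ w ⊓ p                 ≤⟨ x⊓y⊑y _ _ ⟩
          p                       ∎
        where
        w⊓roots≡⊥ : w ⊓ roots ≡ ⊥
        w⊓roots≡⊥ = ⊓≡⊥-antiʳ (x⊑x·⊤ roots) w-avoids-roots

      p⊑bound : p ⊑ F₀.bound
      p⊑bound = ⊑-trans (cond⊑⊔ w p₀² p₀) (⊔-least F₀.f·f⊑bound F₀.f⊑bound)

      p-forest : forest p
      p-forest = F₀.between-forest p-mapping p⊑bound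

      p-roots : p ⊓ 𝟙 ≡ roots
      p-roots = F₀.between-roots roots⊑p p⊑bound

      module Fp = Forest p p-forest

      pᵀ⁺-loops : (p ᵀ) * · p ᵀ ⊓ 𝟙 ⊑ roots
      pᵀ⁺-loops = subst ((p ᵀ) * · p ᵀ ⊓ 𝟙 ⊑_) p-roots Fp.ᵀ⁺⊓𝟙⊑roots

      pᵀ-loops : p ᵀ ⊓ 𝟙 ⊑ roots
      pᵀ-loops = subst (p ᵀ ⊓ 𝟙 ⊑_) p-roots Fp.ᵀ⊓𝟙⊑roots

      y⊓w≡⊥ : y ⊓ w ≡ ⊥
      y⊓w≡⊥ = ⊓≡⊥-sym (⊓≡⊥-antiʳ (x⊑*·x (p₀ ᵀ) y) w-avoids-ancestors)

      pᵀ·y≡p₀ᵀ·y : p ᵀ · y ≡ p₀ ᵀ · y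
      pᵀ·y≡p₀ᵀ·y = cond-ᵀ·-outside p₀² p₀ w-vector y⊓w≡⊥

    module Step {y w : Carrier} (I : Invariant y w) (continue : y ≢ (updated w) ᵀ · y) where
      open Invariant I
      open Consequences I

      y-vector : vector y
      y-vector = point⇒vector y-point

      y-nonroot : y ⊓ rootVector ≡ ⊥
      y-nonroot with point-⊑-or-disjoint _≟_ tarski y-point (·-vector roots ⊤-vector)
      ... | inj₂ disjoint = disjoint
      ... | inj₁ y⊑rootVector =
            ⊥-elim (continue (point-⊑⇒≡ y-point (mapping-ᵀ·-point p-mapping y-point) y⊑pᵀ·y))
        where
        y⊑pᵀ·y : y ⊑ p ᵀ · y
        y⊑pᵀ·y = begin
          y              ≡⟨ sym (trans (∧-comm _ _) (⊑⇒⊓≡ y⊑rootVector)) ⟩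
          rootVector ⊓ y ≤⟨ test·⊤⊓⊑test· y roots⊑𝟙 ⟩
          roots · y      ≤⟨ ·-monoˡ-⊑ y (x⊓𝟙⊑xᵀ p₀) ⟩
          p₀ ᵀ · y       ≡⟨ sym pᵀ·y≡p₀ᵀ·y ⟩
          p ᵀ · y        ∎

      parent grandparent : Carrier
      parent = p₀ ᵀ · y
      grandparent = p₀² ᵀ · y

      parent-point : point parent
      parent-point = mapping-ᵀ·-point p₀-mapping y-point

      grandparent-point : point grandparent
      grandparent-point = mapping-ᵀ·-point p₀²-mapping y-point

      parent⊓w≡⊥ : parent ⊓ w ≡ ⊥
      parent⊓w≡⊥ = ⊓≡⊥-sym (⊓≡⊥-antiʳ (·-monoˡ-⊑ y (x⊑x* (p₀ ᵀ))) w-avoids-ancestors)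

      parent⊓y≡⊥ : parent ⊓ y ≡ ⊥
      parent⊓y≡⊥ = trans (cong (_⊓ y) (sym pᵀ·y≡p₀ᵀ·y))
                         (⊓≡⊥-sym (injective⇒⊓·≡⊥ (p ᵀ) (point⇒injective y-point) roots⊑𝟙 y-nonroot pᵀ-loops))

      pᵀ·pᵀ·y≡grandparent : p ᵀ · p ᵀ · y ≡ grandparent
      pᵀ·pᵀ·y≡grandparent = begin-equality
          p ᵀ · p ᵀ · y        ≡⟨ *-assoc _ _ _ ⟩
          p ᵀ · (p ᵀ · y)      ≡⟨ cong (p ᵀ ·_) pᵀ·y≡p₀ᵀ·y ⟩
          p ᵀ · parent         ≡⟨ cond-ᵀ·-outside p₀² p₀ w-vector parent⊓w≡⊥ ⟩
          p₀ ᵀ · (p₀ ᵀ · y)    ≡⟨ sym (*-assoc _ _ _) ⟩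
          p₀ ᵀ · p₀ ᵀ · y      ≡⟨ cong (_· y) (sym (ᵀ-· p₀ p₀)) ⟩
          grandparent          ∎

      p′ : Carrier
      p′ = body-p p y

      y⊓link≡y⊓p₀² : y ⊓ (p ᵀ · p ᵀ · y) ᵀ ≡ y ⊓ p₀²
      y⊓link≡y⊓p₀² = trans (cong (λ u → y ⊓ u ᵀ) pᵀ·pᵀ·y≡grandparent) (sym (point-⊓ p₀² y-point))

      p′≡updated : p′ ≡ updated (w ⊔ y)
      p′≡updated = cond-⊔ p′
          (trans (⊓-cond-⊑∁ _ p (⊓≡⊥⇒⊑∁ (⊓≡⊥-sym y⊓w≡⊥))) (⊓-cond w p₀² p₀))
          (trans (⊓-cond y _ p) y⊓link≡y⊓p₀²)
          (trans (⊓-cond-⊑∁ _ p (∁-anti-⊑ (y⊑x⊔y w y))) (⊓-cond-⊑∁ p₀² p₀ (∁-anti-⊑ (x⊑x⊔y w y))))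

      p′ᵀ·y≡grandparent : p′ ᵀ · y ≡ grandparent
      p′ᵀ·y≡grandparent = begin-equality
          p′ ᵀ · y                 ≡⟨ cond-ᵀ·-inside _ p y-vector ⊑-refl ⟩
          ((p ᵀ · p ᵀ · y) ᵀ) ᵀ · y ≡⟨ cong (_· y) (trans (ᵀ-invol _) pᵀ·pᵀ·y≡grandparent) ⟩
          grandparent · y          ≡⟨ vector-·-surjective (point⇒vector grandparent-point) (point⇒surjective y-point) ⟩
          grandparent              ∎

      p′ᵀ·parent≡grandparent : p′ ᵀ · parent ≡ grandparent
      p′ᵀ·parent≡grandparent = begin-equality
          p′ ᵀ · parent      ≡⟨ cond-ᵀ·-outside _ p y-vector parent⊓y≡⊥ ⟩
          p ᵀ · parent       ≡⟨ cong (p ᵀ ·_) (sym pᵀ·y≡p₀ᵀ·y) ⟩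
          p ᵀ · (p ᵀ · y)    ≡⟨ sym (*-assoc _ _ _) ⟩
          p ᵀ · p ᵀ · y      ≡⟨ pᵀ·pᵀ·y≡grandparent ⟩
          grandparent        ∎

      p′-mapping : mapping p′
      p′-mapping = subst mapping (sym p′≡updated) (cond-mapping (⊔-vector w-vector y-vector) p₀²-mapping p₀-mapping)

      next-avoids-ancestors : (w ⊔ y) ⊓ ancestors₀ · grandparent ≡ ⊥
      next-avoids-ancestors = ⊑⊥⇒≡⊥ (begin
          (w ⊔ y) ⊓ ancestors₀ · grandparent                    ≡⟨ ∧-distribʳ-∨ _ _ _ ⟩
          w ⊓ ancestors₀ · grandparent ⊔ y ⊓ ancestors₀ · grandparent
            ≤⟨ ⊔-mono-⊑ (⊓-mono-⊑ ⊑-refl (⊑-trans above-y (·-monoˡ-⊑ y (x*·x⊑x* (p₀ ᵀ)))))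
                        (⊓-mono-⊑ ⊑-refl above-y) ⟩
          w ⊓ ancestors₀ · y ⊔ y ⊓ strictAncestors₀ · y
            ≡⟨ cong₂ _⊔_ w-avoids-ancestors
                         (injective⇒⊓·≡⊥ _ (point⇒injective y-point) roots⊑𝟙 y-nonroot F₀.ᵀ⁺⊓𝟙⊑roots) ⟩
          ⊥ ⊔ ⊥                                                  ≡⟨ ⊔-idem ⊥ ⟩
          ⊥                                                      ∎)
        where
        strictAncestors₀ : Carrier
        strictAncestors₀ = ancestors₀ · p₀ ᵀ
        above-y : ancestors₀ · grandparent ⊑ strictAncestors₀ · y
        above-y = begin
          ancestors₀ · (p₀² ᵀ · y)          ≡⟨ cong (λ u → ancestors₀ · (u · y)) (ᵀ-· p₀ p₀) ⟩
          ancestors₀ · (p₀ ᵀ · p₀ ᵀ · y)    ≡⟨ sym (*-assoc _ _ _) ⟩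
          ancestors₀ · (p₀ ᵀ · p₀ ᵀ) · y    ≡⟨ cong (_· y) (sym (*-assoc _ _ _)) ⟩
          ancestors₀ · p₀ ᵀ · p₀ ᵀ · y      ≤⟨ ·-monoˡ-⊑ y (·-monoˡ-⊑ (p₀ ᵀ) (x*·x⊑x* (p₀ ᵀ))) ⟩
          strictAncestors₀ · y              ∎

      next-evenReach-split : (p₀² ᵀ) * · x ≡ (w ⊔ y) ⊔ (p₀² ᵀ) * · grandparent
      next-evenReach-split = begin-equality
          (p₀² ᵀ) * · x                                  ≡⟨ evenReach-split ⟩
          w ⊔ (p₀² ᵀ) * · y                              ≡⟨ cong (λ u → w ⊔ u · y) (sym (*-unfoldʳ (p₀² ᵀ))) ⟩
          w ⊔ (𝟙 ⊔ (p₀² ᵀ) * · p₀² ᵀ) · y                ≡⟨ cong (w ⊔_) (distribʳ _ _ _) ⟩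
          w ⊔ (𝟙 · y ⊔ (p₀² ᵀ) * · p₀² ᵀ · y)            ≡⟨ cong₂ (λ u v → w ⊔ (u ⊔ v)) (*-identityˡ y) (*-assoc _ _ _) ⟩
          w ⊔ (y ⊔ (p₀² ᵀ) * · grandparent)              ≡⟨ sym (∨-assoc _ _ _) ⟩
          (w ⊔ y) ⊔ (p₀² ᵀ) * · grandparent              ∎

      next-avoids-roots : (w ⊔ y) ⊓ rootVector ≡ ⊥
      next-avoids-roots = trans (∧-distribʳ-∨ _ _ _) (trans (cong₂ _⊔_ w-avoids-roots y-nonroot) (⊔-idem ⊥))

      -- A node reachable from x in p is reachable in p′ (p and p′ differ only at y)
      -- or lies strictly above y, and y does not lie strictly above itself in a forest.
      y-reachable′ : y ⊑ (p′ ᵀ) * · x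
      y-reachable′ = ⊑⊔-cancelʳ (⊑-trans y-reachable reach)
                       (injective⇒⊓·≡⊥ _ (point⇒injective y-point) roots⊑𝟙 y-nonroot pᵀ⁺-loops)
        where
        Z : Carrier
        Z = (p′ ᵀ) * · x
        p′ᵀ·Z⊑Z : p′ ᵀ · Z ⊑ Z
        p′ᵀ·Z⊑Z = ⊑-trans (⊑-reflexive (sym (*-assoc _ _ _))) (·-monoˡ-⊑ x (x·x*⊑x* _))
        pᵀ·y⊑ : p ᵀ · y ⊑ (p ᵀ) * · p ᵀ · y
        pᵀ·y⊑ = ·-monoˡ-⊑ y (x⊑*·x (p ᵀ) (p ᵀ))
        pᵀ·Z⊑ : p ᵀ · Z ⊑ Z ⊔ (p ᵀ) * · p ᵀ · y
        pᵀ·Z⊑ = begin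
          p ᵀ · Z                              ≡⟨ cong (p ᵀ ·_) (⊓-partition y Z) ⟩
          p ᵀ · (y ⊓ Z ⊔ ∁ y ⊓ Z)              ≡⟨ distribˡ _ _ _ ⟩
          p ᵀ · (y ⊓ Z) ⊔ p ᵀ · (∁ y ⊓ Z)
            ≤⟨ ⊔-mono-⊑ (⊑-trans (·-monoʳ-⊑ (p ᵀ) (x⊓y⊑x y Z)) pᵀ·y⊑)
                        (⊑-trans (y⊑x⊔y _ _) (⊑-trans (⊑-reflexive (sym (cond-ᵀ· _ p Z y-vector))) p′ᵀ·Z⊑Z)) ⟩
          (p ᵀ) * · p ᵀ · y ⊔ Z                 ≡⟨ ∨-comm _ _ ⟩
          Z ⊔ (p ᵀ) * · p ᵀ · y                 ∎
        pᵀ·pᵀ⁺·y⊑ : p ᵀ · ((p ᵀ) * · p ᵀ · y) ⊑ (p ᵀ) * · p ᵀ · y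
        pᵀ·pᵀ⁺·y⊑ = begin
          p ᵀ · ((p ᵀ) * · p ᵀ · y)   ≡⟨ sym (*-assoc _ _ _) ⟩
          p ᵀ · ((p ᵀ) * · p ᵀ) · y   ≡⟨ cong (_· y) (sym (*-assoc _ _ _)) ⟩
          p ᵀ · (p ᵀ) * · p ᵀ · y     ≤⟨ ·-monoˡ-⊑ y (·-monoˡ-⊑ (p ᵀ) (x·x*⊑x* _)) ⟩
          (p ᵀ) * · p ᵀ · y           ∎
        reach : (p ᵀ) * · x ⊑ Z ⊔ (p ᵀ) * · p ᵀ · y
        reach = *-inductˡ′ (⊑-trans (x⊑*·x _ x) (x⊑x⊔y _ _)) (begin
          p ᵀ · (Z ⊔ (p ᵀ) * · p ᵀ · y)                         ≡⟨ distribˡ _ _ _ ⟩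
          p ᵀ · Z ⊔ p ᵀ · ((p ᵀ) * · p ᵀ · y)                   ≤⟨ ⊔-mono-⊑ pᵀ·Z⊑ pᵀ·pᵀ⁺·y⊑ ⟩
          (Z ⊔ (p ᵀ) * · p ᵀ · y) ⊔ (p ᵀ) * · p ᵀ · y           ≡⟨ ∨-assoc _ _ _ ⟩
          Z ⊔ ((p ᵀ) * · p ᵀ · y ⊔ (p ᵀ) * · p ᵀ · y)           ≡⟨ cong (Z ⊔_) (⊔-idem _) ⟩
          Z ⊔ (p ᵀ) * · p ᵀ · y                                 ∎)

      next-reachable : p′ ᵀ · y ⊑ (p′ ᵀ) * · x
      next-reachable = ⊑-trans (·-monoʳ-⊑ _ y-reachable′) (⊑-trans (⊑-reflexive (sym (*-assoc _ _ _))) (·-monoˡ-⊑ x (x·x*⊑x* _)))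

      next-visited-closed : p′ ᵀ · (w ⊔ y) ⊑ (w ⊔ y) ⊔ p′ ᵀ · y
      next-visited-closed = begin
          p′ ᵀ · (w ⊔ y)             ≡⟨ distribˡ _ _ _ ⟩
          p′ ᵀ · w ⊔ p′ ᵀ · y        ≡⟨ cong (_⊔ p′ ᵀ · y) (cond-ᵀ·-outside _ p y-vector (⊓≡⊥-sym y⊓w≡⊥)) ⟩
          p ᵀ · w ⊔ p′ ᵀ · y         ≤⟨ ⊔-mono-⊑ visited-closed ⊑-refl ⟩
          (w ⊔ y) ⊔ p′ ᵀ · y         ∎

      connected-p′⊑ : connected p′ ⊑ connected p
      connected-p′⊑ = connected-least (proj₁ p-mapping) (begin
          y ⊓ (p ᵀ · p ᵀ · y) ᵀ ⊔ ∁ y ⊓ p ≤⟨ ⊔-mono-⊑ y⊓link⊑p·p (x⊓y⊑y _ _) ⟩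
          p · p ⊔ p                      ≤⟨ ⊔-least (⊑-trans (·-mono-⊑ (x⊑x* p) (x⊑x* p)) (⊑-trans (*·*⊑* p) p*⊑))
                                                    (⊑-trans (x⊑x* p) p*⊑) ⟩
          connected p                    ∎)
        where
        p*⊑ : p * ⊑ connected p
        p*⊑ = ⊑-trans (⊑-reflexive (sym (*-identityʳ _))) (·-monoʳ-⊑ (p *) (𝟙⊑* _))
        y⊓link⊑p·p : y ⊓ (p ᵀ · p ᵀ · y) ᵀ ⊑ p · p
        y⊓link⊑p·p = begin
          y ⊓ (p ᵀ · p ᵀ · y) ᵀ  ≡⟨ cong (λ u → y ⊓ (u · y) ᵀ) (sym (ᵀ-· p p)) ⟩
          y ⊓ ((p · p) ᵀ · y) ᵀ  ≡⟨ sym (point-⊓ (p · p) y-point) ⟩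
          y ⊓ p · p              ≤⟨ x⊓y⊑y _ _ ⟩
          p · p                  ∎

      -- The arc from y to its parent is recovered in p′ as y → g ← parent, where g
      -- is the common new parent of both.
      connected-⊑p′ : connected p ⊑ connected p′
      connected-⊑p′ = connected-least (proj₁ p′-mapping) (begin
          p                       ≡⟨ ⊓-partition y p ⟩
          y ⊓ p ⊔ ∁ y ⊓ p         ≤⟨ ⊔-mono-⊑ y⊓p⊑ ∁y⊓p⊑ ⟩
          connected p′ ⊔ connected p′ ≡⟨ ⊔-idem _ ⟩
          connected p′            ∎)
        where
        g : Carrier
        g = grandparent
        ⊑p′ : ∀ {u} → point u → p′ ᵀ · u ≡ g → u · g ᵀ ⊑ p′
        ⊑p′ {u} u-point p′ᵀ·u≡g = begin
          u · g ᵀ               ≡⟨ cong (λ v → u · v ᵀ) (sym p′ᵀ·u≡g) ⟩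
          u · (p′ ᵀ · u) ᵀ      ≡⟨ cong (u ·_) (ᵀ·-ᵀ p′ u) ⟩
          u · (u ᵀ · p′)        ≡⟨ sym (*-assoc _ _ _) ⟩
          u · u ᵀ · p′          ≤⟨ ·-monoˡ-⊑ p′ (point⇒injective u-point) ⟩
          𝟙 · p′                ≡⟨ *-identityˡ _ ⟩
          p′                    ∎
        ∁y⊓p⊑ : ∁ y ⊓ p ⊑ connected p′
        ∁y⊓p⊑ = ⊑-trans (⊑-reflexive (sym (∁⊓-cond y _ p))) (⊑-trans (x⊓y⊑y _ _) (x⊑connected p′))
        y⊓p⊑ : y ⊓ p ⊑ connected p′
        y⊓p⊑ = begin
          y ⊓ p                          ≡⟨ point-⊓ p y-point ⟩
          y ⊓ (p ᵀ · y) ᵀ                ≡⟨ cong (λ u → y ⊓ u ᵀ) pᵀ·y≡p₀ᵀ·y ⟩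
          y ⊓ parent ᵀ                   ≤⟨ vector-⊓⊑· parent y-vector ⟩
          y · parent ᵀ                   ≡⟨ cong (y ·_) (sym (*-identityˡ _)) ⟩
          y · (𝟙 · parent ᵀ)             ≤⟨ ·-monoʳ-⊑ y (·-monoˡ-⊑ (parent ᵀ) (point⇒surjective grandparent-point)) ⟩
          y · (g ᵀ · g · parent ᵀ)       ≡⟨ cong (y ·_) (*-assoc _ _ _) ⟩
          y · (g ᵀ · (g · parent ᵀ))     ≡⟨ sym (*-assoc _ _ _) ⟩
          y · g ᵀ · (g · parent ᵀ)       ≡⟨ cong (λ u → y · g ᵀ · (u · parent ᵀ)) (sym (ᵀ-invol g)) ⟩
          y · g ᵀ · ((g ᵀ) ᵀ · parent ᵀ) ≡⟨ cong (y · g ᵀ ·_) (sym (ᵀ-· parent (g ᵀ))) ⟩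
          y · g ᵀ · (parent · g ᵀ) ᵀ
            ≤⟨ ·-mono-⊑ (⊑p′ y-point p′ᵀ·y≡grandparent) (ᵀ-mono-⊑ (⊑p′ parent-point p′ᵀ·parent≡grandparent)) ⟩
          p′ · p′ ᵀ                      ≤⟨ x·xᵀ⊑connected p′ ⟩
          connected p′                   ∎

      next : Invariant (p′ ᵀ · y) (w ⊔ y)
      next = record
        { y-point = subst point (sym p′ᵀ·y≡grandparent) grandparent-point
        ; w-vector = ⊔-vector w-vector y-vector
        ; w-avoids-ancestors = subst (λ u → (w ⊔ y) ⊓ ancestors₀ · u ≡ ⊥) (sym p′ᵀ·y≡grandparent) next-avoids-ancestors
        ; evenReach-split = subst (λ u → (p₀² ᵀ) * · x ≡ (w ⊔ y) ⊔ (p₀² ᵀ) * · u) (sym p′ᵀ·y≡grandparent) next-evenReach-split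
        ; w-avoids-roots = next-avoids-roots
        ; y-reachable = subst (λ u → p′ ᵀ · y ⊑ (u ᵀ) * · x) p′≡updated next-reachable
        ; x-visited = ⊑-trans x-visited (x⊑x⊔y _ _)
        ; visited-closed = subst (λ u → u ᵀ · (w ⊔ y) ⊑ (w ⊔ y) ⊔ p′ ᵀ · y) p′≡updated next-visited-closed
        ; connected-invariant = trans (cong connected (sym p′≡updated))
                                      (trans (⊑-antisym connected-p′⊑ connected-⊑p′) connected-invariant)
        }

      progress : (w ⊔ y) ⊐ w
      progress = x⊑x⊔y w y , λ w⊔y⊑w → continue (trans (y≡⊥ w⊔y⊑w) (sym (trans (cong (p ᵀ ·_) (y≡⊥ w⊔y⊑w)) (zeroʳ _))))
        where
        y≡⊥ : w ⊔ y ⊑ w → y ≡ ⊥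
        y≡⊥ w⊔y⊑w = trans (sym (⊑⇒⊓≡ (⊑-trans (y⊑x⊔y w y) w⊔y⊑w))) y⊓w≡⊥

    Postcondition : Carrier → Carrier → Set ℓ
    Postcondition p y =
         forest p
       × point y
       × y ≡ ((p ᵀ) * · x) ⊓ ((p ⊓ 𝟙) · ⊤)
       × p * · (p ᵀ) * ≡ p₀ * · (p₀ ᵀ) *
       × p ⊓ 𝟙 ≡ p₀ ⊓ 𝟙
       × p ≡ ((((p₀ · p₀) ᵀ) * · x) ⊓ (p₀ · p₀)) ⊔ (∁ (((p₀ · p₀) ᵀ) * · x) ⊓ p₀)

    module Exit {y w : Carrier} (I : Invariant y w) (exit : y ≡ (updated w) ᵀ · y) where
      open Invariant I
      open Consequences I

      y⊑rootVector : y ⊑ rootVector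
      y⊑rootVector = ⊑-trans (injective-⊑·⇒⊑⊓𝟙·⊤ (p ᵀ) (point⇒injective y-point) (⊑-reflexive exit))
                             (·-monoˡ-⊑ ⊤ pᵀ-loops)

      reachable⊑visited : (p ᵀ) * · x ⊑ w ⊔ y
      reachable⊑visited = *-inductˡ′ x-visited (begin
          p ᵀ · (w ⊔ y)           ≡⟨ distribˡ _ _ _ ⟩
          p ᵀ · w ⊔ p ᵀ · y       ≤⟨ ⊔-least visited-closed (⊑-trans (⊑-reflexive (sym exit)) (y⊑x⊔y w y)) ⟩
          w ⊔ y                   ∎)

      y-root-reached : y ≡ ((p ᵀ) * · x) ⊓ ((p ⊓ 𝟙) · ⊤)
      y-root-reached = trans (⊑-antisym (⊓-greatest y-reachable y⊑rootVector) reached-root⊑y)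
                             (cong (λ u → ((p ᵀ) * · x) ⊓ u · ⊤) (sym p-roots))
        where
        reached-root⊑y : (p ᵀ) * · x ⊓ rootVector ⊑ y
        reached-root⊑y = ⊑⊔-cancelʳ (⊑-trans (x⊓y⊑x _ _) (⊑-trans reachable⊑visited (⊑-reflexive (∨-comm w y))))
                                    (⊓≡⊥-antiˡ (x⊓y⊑y _ rootVector) (⊓≡⊥-sym w-avoids-roots))

      p₀ᵀ·y≡y : p₀ ᵀ · y ≡ y
      p₀ᵀ·y≡y = sym (trans exit pᵀ·y≡p₀ᵀ·y)

      p₀²ᵀ·y≡y : p₀² ᵀ · y ≡ y
      p₀²ᵀ·y≡y = trans (cong (_· y) (ᵀ-· p₀ p₀)) (trans (*-assoc _ _ _) (trans (cong (p₀ ᵀ ·_) p₀ᵀ·y≡y) p₀ᵀ·y≡y))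

      evenReach≡visited : (p₀² ᵀ) * · x ≡ w ⊔ y
      evenReach≡visited = trans evenReach-split (cong (w ⊔_) p₀²ᵀ*·y≡y)
        where
        p₀²ᵀ*·y≡y : (p₀² ᵀ) * · y ≡ y
        p₀²ᵀ*·y≡y = ⊑-antisym (*-inductˡ′ ⊑-refl (⊑-reflexive p₀²ᵀ·y≡y)) (x⊑*·x _ y)

      y⊓p₀≡y⊓p₀² : y ⊓ p₀ ≡ y ⊓ p₀²
      y⊓p₀≡y⊓p₀² = trans (point-⊓ p₀ y-point)
                         (trans (cong (λ u → y ⊓ u ᵀ) (trans p₀ᵀ·y≡y (sym p₀²ᵀ·y≡y))) (sym (point-⊓ p₀² y-point)))

      p≡updated-evenReach : p ≡ updated ((p₀² ᵀ) * · x)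
      p≡updated-evenReach = trans
          (cond-⊔ p (⊓-cond w p₀² p₀)
                  (trans (⊓-cond-⊑∁ p₀² p₀ (⊓≡⊥⇒⊑∁ y⊓w≡⊥)) y⊓p₀≡y⊓p₀²)
                  (⊓-cond-⊑∁ p₀² p₀ (∁-anti-⊑ (x⊑x⊔y w y))))
          (cong updated (sym evenReach≡visited))

      postcondition : Postcondition p y
      postcondition = p-forest , y-point , y-root-reached , connected-invariant , p-roots , p≡updated-evenReach

    correct-from : ∀ {p y p′ y′} w → p ≡ updated w → Invariant y w → Loop p y p′ y′ → Postcondition p′ y′
    correct-from w refl I (loop-exit exit) = Exit.postcondition I exit
    correct-from {y = y} w refl I (loop-step continue L) =
      correct-from (w ⊔ y) (Step.p′≡updated I continue) (Step.next I continue) L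

    correct : ∀ p y → Loop p₀ x p y → Postcondition p y
    correct p y = correct-from ⊥ (sym updated-⊥) initial

    terminates-from : ∀ {y w} → Acc _⊐_ w → Invariant y w → ∃₂ λ p′ y′ → Loop (updated w) y p′ y′
    terminates-from {y} {w} (acc rs) I with y ≟ ((updated w) ᵀ · y)
    ... | yes exit = updated w , y , loop-exit exit
    ... | no continue with terminates-from (rs (Step.progress I continue)) (Step.next I continue)
    ...   | p′ , y′ , L = p′ , y′ , loop-step continue
              (subst (λ u → Loop u (body-p (updated w) y ᵀ · y) p′ y′) (sym (Step.p′≡updated I continue)) L)

    terminates : WellFounded _⊐_ → ∃₂ λ p y → Loop p₀ x p y
    terminates wf with terminates-from (wf ⊥) initial
    ... | p , y , L = p , y , subst (λ u → Loop u x p y) updated-⊥ L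


mainTheorem19 : ∀ {a : Level} (S : KleeneRelationAlgebra a) →
    let open KleeneRelationAlgebra S in
    Finite → Tarski → ∀ (p₀ x : Carrier) → forest p₀ → point x →
    -- the program terminates
    (∃₂ λ p y → Run p₀ x p y)
    ×
    -- and every final state satisfies the postconditions
    (∀ p y → Run p₀ x p y →
       forest p
       × point y
       × y ≡ ((p ᵀ) * · x) ⊓ ((p ⊓ 𝟙) · ⊤)
       × p * · (p ᵀ) * ≡ p₀ * · (p₀ ᵀ) *
       × p ⊓ 𝟙 ≡ p₀ ⊓ 𝟙
       × p ≡ ((((p₀ · p₀) ᵀ) * · x) ⊓ (p₀ · p₀)) ⊔ (∁ (((p₀ · p₀) ᵀ) * · x) ⊓ p₀))
mainTheorem19 S finite tarski p₀ x p₀-forest x-point = terminates (⊐-wellFounded finite) , correct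
  where
  open Properties S
  open Algorithm (finite⇒≟ finite) tarski p₀ x p₀-forest x-point
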